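{- Let $0<p<1$ and $G\sim G_{n,p}$. For every proper shape $\alpha$, \[ \mathbb{E}\left[\operatorname{tr}\left(M_\alpha M_\alpha^\intercal\right)\right] \le |\mathrm{Aut}(\alpha)|\, n^{|V(\alpha)| + |I_\alpha|}. \]
   Context: A graph $G$ on $[n]$ is identified with $G\in\{0,1\}^{\binom{[n]}{2}}$; the $p$-biased character is $\chi(0)=\sqrt{p/(1-p)}$, $\chi(1)=-\sqrt{(1-p)/p}$, and $\chi_H(G)=\prod_{e\in H}\chi(G_e)$. A shape $\alpha=(V(\alpha),E(\alpha),U_\alpha,V_\alpha)$ is a finite multigraph without self-loops with two vertex subsets $U_\alpha,V_\alpha\subseteq V(\alpha)$; it is proper if it has no multi-edges. For an injective map $\varphi:V(\alpha)\to[n]$, $M_{\varphi(\alpha)}$ is the matrix with rows and columns indexed by all subsets of $[n]$ whose only nonzero entry is at row $\varphi(U_\alpha)$, column $\varphi(V_\alpha)$, equal to $\chi_{\{\{\varphi(a),\varphi(b)\}:\{a,b\}\in E(\alpha)\}}(G)$. The graph matrix is $M_\alpha=\sum_{\varphi:V(\alpha)\to[n]\text{ injective}}M_{\varphi(\alpha)}$. $\mathrm{Aut}(\alpha)$ is the group of bijections $V(\alpha)\to V(\alpha)$ that map $U_\alpha$ to itself and $V_\alpha$ to itself (as sets) and are multigraph automorphisms of $E(\alpha)$. $I_\alpha$ is the set of vertices of $V(\alpha)\setminus(U_\alpha\cup V_\alpha)$ of degree $0$. -}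

module Defs where

open import Level using (0ℓ)
open import Algebra.Bundles using (CommutativeRing)
open import Relation.Binary.Core using (Rel)
open import Relation.Binary.Structures using (IsTotalOrder)
open import Relation.Binary.PropositionalEquality using (_≡_; _≢_)
open import Relation.Nullary using (¬_)
open import Relation.Nullary.Decidable using (⌊_⌋)
open import Data.Nat as ℕ using (ℕ; zero; suc)
open import Data.Bool as B using (Bool; true; false; _∧_; _∨_; not; if_then_else_)
open import Data.Fin as F using (Fin; toℕ)
open import Data.Fin.Subset using (Subset)
open import Data.Product using (Σ; _×_; _,_; proj₁; proj₂)
open import Data.List as L using (List; []; _∷_; map; foldr; filter; filterᵇ; length; concatMap; allFin)
open import Data.Bool.ListAction using (all; any)
open import Data.List.Relation.Unary.All using (All)
open import Data.List.Relation.Unary.AllPairs using (AllPairs)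
open import Data.Vec as V using (Vec)
open import Data.Vec.Properties using (≡-dec)

-- Ordered fields (the stdlib has no reals; the theorem is stated for an
-- arbitrary ordered field, which includes ℝ).

record OrderedField : Set₁ where
  field
    commutativeRing : CommutativeRing 0ℓ 0ℓ
  open CommutativeRing commutativeRing public
  field
    _≤_          : Rel Carrier 0ℓ
    isTotalOrder : IsTotalOrder _≈_ _≤_
    +-mono-≤     : ∀ {x y} z → x ≤ y → (x + z) ≤ (y + z)
    *-nonneg     : ∀ {x y} → 0# ≤ x → 0# ≤ y → 0# ≤ (x * y)
    0≉1          : ¬ (0# ≈ 1#)
    inverse      : ∀ x → ¬ (x ≈ 0#) → Σ Carrier (λ y → (x * y) ≈ 1#)

  _<_ : Rel Carrier 0ℓ
  x < y = (x ≤ y) × ¬ (x ≈ y)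

  sumF : List Carrier → Carrier
  sumF = foldr _+_ 0#

  prodF : List Carrier → Carrier
  prodF = foldr _*_ 1#

  ι : ℕ → Carrier
  ι zero    = 0#
  ι (suc m) = 1# + ι m

allVecs : ∀ {A : Set} → List A → (k : ℕ) → List (Vec A k)
allVecs xs zero    = V.[] ∷ []
allVecs xs (suc k) = concatMap (λ x → map (x V.∷_) (allVecs xs k)) xs

bitLists : ℕ → List (List Bool)
bitLists N = map V.toList (allVecs (true ∷ false ∷ []) N)

allSubsets : (n : ℕ) → List (Subset n)
allSubsets n = allVecs (true ∷ false ∷ []) n

eqFin : ∀ {n} → Fin n → Fin n → Bool
eqFin i j = ⌊ i F.≟ j ⌋

eqSubset : ∀ {n} → Subset n → Subset n → Bool
eqSubset S T = ⌊ ≡-dec B._≟_ S T ⌋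

sameEdge : ∀ {n} → Fin n × Fin n → Fin n × Fin n → Bool
sameEdge (a , b) (c , d) = (eqFin a c ∧ eqFin b d) ∨ (eqFin a d ∧ eqFin b c)

-- Shapes: finite multigraph without self-loops on vertex set Fin k,
-- edges given as a list (multi-edges = repeated unordered pairs),
-- with two distinguished vertex subsets U and V.

record Shape : Set where
  field
    k        : ℕ
    E        : List (Fin k × Fin k)
    U        : Subset k
    V        : Subset k
    loopless : All (λ e → proj₁ e ≢ proj₂ e) E
open Shape public

Proper : Shape → Set
Proper α = AllPairs (λ e f → sameEdge e f ≡ false) (E α)

injectiveᵇ : ∀ {k n} → Vec (Fin n) k → Bool
injectiveᵇ {k} φ =
  all (λ i → all (λ j → not (eqFin (V.lookup φ i) (V.lookup φ j)) ∨ eqFin i j) (allFin k)) (allFin k)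

image : ∀ {k n} → Vec (Fin n) k → Subset k → Subset n
image {k} φ S = V.tabulate (λ y → any (λ x → V.lookup S x ∧ eqFin (V.lookup φ x) y) (allFin k))

-- Graphs on [n]: a graph is a 0/1 vector indexed by the pairs {i,j}, i<j,
-- encoded as a list of bits aligned with the list `pairs n`.

pairs : (n : ℕ) → List (Fin n × Fin n)
pairs n = filter (λ e → toℕ (proj₁ e) ℕ.<? toℕ (proj₂ e))
                 (concatMap (λ i → map (i ,_) (allFin n)) (allFin n))

Graph : ℕ → Set
Graph n = List Bool

allGraphs : (n : ℕ) → List (Graph n)
allGraphs n = bitLists (length (pairs n))

edgeBit′ : ∀ {n} → List (Fin n × Fin n) → List Bool → Fin n → Fin n → Bool
edgeBit′ (e ∷ es) (b ∷ bs) x y = if sameEdge e (x , y) then b else edgeBit′ es bs x y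
edgeBit′ _        _        x y = false

edgeBit : ∀ {n} → Graph n → Fin n → Fin n → Bool
edgeBit {n} G = edgeBit′ (pairs n) G

-- Everything below is relative to an ordered field F and parameters
-- p, s, t with s = sqrt(p/(1-p)) and t = sqrt((1-p)/p) = 1/s.

module _ (𝔽 : OrderedField) where
  open OrderedField 𝔽

  χ : Carrier → Carrier → Bool → Carrier
  χ s t false = s
  χ s t true  = - t

  weight : Carrier → List Bool → Carrier
  weight p G = prodF (map (λ b → if b then p else (1# - p)) G)

  χImage : Carrier → Carrier → ∀ {n} (α : Shape) → Vec (Fin n) (k α) → Graph n → Carrier
  χImage s t α φ G =
    prodF (map (λ e → χ s t (edgeBit G (V.lookup φ (proj₁ e)) (V.lookup φ (proj₂ e)))) (E α))

  Mentry : Carrier → Carrier → (n : ℕ) (α : Shape) → Graph n → Subset n → Subset n → Carrier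
  Mentry s t n α G S T =
    sumF (map (λ φ → if injectiveᵇ φ ∧ eqSubset (image φ (U α)) S ∧ eqSubset (image φ (V α)) T
                     then χImage s t α φ G else 0#)
              (allVecs (allFin n) (k α)))

  -- tr(M_α M_αᵀ) = Σ_S (M_α M_αᵀ)_{S,S} = Σ_S Σ_T M_α[S,T] M_α[S,T]
  trMMt : Carrier → Carrier → (n : ℕ) (α : Shape) → Graph n → Carrier
  trMMt s t n α G =
    sumF (map (λ S → sumF (map (λ T → Mentry s t n α G S T * Mentry s t n α G S T) (allSubsets n)))
              (allSubsets n))

  expectedTr : Carrier → Carrier → Carrier → (n : ℕ) (α : Shape) → Carrier
  expectedTr p s t n α = sumF (map (λ G → weight p G * trMMt s t n α G) (allGraphs n))

mult : (α : Shape) → Fin (k α) → Fin (k α) → ℕ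
mult α a b = length (filterᵇ (sameEdge (a , b)) (E α))

isAutᵇ : (α : Shape) → Vec (Fin (k α)) (k α) → Bool
isAutᵇ α σ =
  injectiveᵇ σ ∧ eqSubset (image σ (U α)) (U α) ∧ eqSubset (image σ (V α)) (V α)
  ∧ all (λ a → all (λ b → ⌊ mult α a b ℕ.≟ mult α (V.lookup σ a) (V.lookup σ b) ⌋) (allFin (k α))) (allFin (k α))

-- |Aut(α)|: number of bijections Fin k → Fin k (= injective maps) that are automorphisms
autCount : Shape → ℕ
autCount α = length (filterᵇ (isAutᵇ α) (allVecs (allFin (k α)) (k α)))

degree : (α : Shape) → Fin (k α) → ℕ
degree α x = length (filterᵇ (λ e → eqFin (proj₁ e) x ∨ eqFin (proj₂ e) x) (E α))

isolatedCount : Shape → ℕ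
isolatedCount α =
  length (filterᵇ (λ x → not (V.lookup (U α) x ∨ V.lookup (V α) x) ∧ ⌊ degree α x ℕ.≟ 0 ⌋) (allFin (k α)))

{-# OPTIONS --safe #-}
-- Expanding the square, E tr(M_α M_αᵀ) is a sum over pairs of injective maps φ, ψ with
-- φ(U_α) = ψ(U_α) and φ(V_α) = ψ(V_α) of E[χ_{φ(E(α))} χ_{ψ(E(α))}].  As E χ(G_e) = 0 and
-- E χ(G_e)² = 1 and a proper α has edge images without repetitions, this expectation is 1 when
-- φ(E(α)) = ψ(E(α)) and 0 otherwise.  In the first case φ⁻¹ ∘ ψ, extended by the identity on
-- I_α, is an automorphism σ of α with ψ = φ ∘ σ off I_α.  So each of the n^|V(α)| maps φ is
-- paired with at most |Aut(α)| n^|I_α| maps ψ.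
module Submission where

open import Defs
open import Data.Nat using (ℕ; _^_) renaming (_*_ to _*ℕ_; _+_ to _+ℕ_)

open import Data.Nat as ℕ using (zero; suc)
open import Data.Bool as B using (Bool; true; false; _∧_; _∨_; not; if_then_else_)
import Data.Bool.Properties as BP
open import Data.Bool.ListAction using (all; any; and)
open import Data.Fin as F using (Fin; toℕ)
import Data.Fin.Properties as FinP
open import Data.Fin.Subset using (Subset)
open import Data.List as L using (List; []; _∷_; map; filterᵇ; length; concatMap; allFin)
open import Data.List.Membership.Propositional using (_∈_; find; lose)
open import Data.List.Membership.Propositional.Properties using (∈-allFin; ∈-map⁺; ∈-concatMap⁺; ∈-filter⁺)
open import Data.List.Relation.Unary.Any as Any using (Any; here; there)
import Data.List.Relation.Unary.Any.Properties as AnyP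
open import Data.List.Relation.Unary.All as All using (All)
import Data.List.Relation.Unary.All.Properties as AllP
open import Data.List.Relation.Unary.AllPairs as AllPairs using (AllPairs)
import Data.List.Relation.Unary.AllPairs.Properties as AllPairsP
open import Data.Vec as V using (Vec)
open import Data.List.Properties using (map-tabulate; map-∘; length-tabulate)
open import Data.Nat.Properties using (^-distribˡ-+-*)
open import Data.Vec.Properties using (≡-dec; lookup∘tabulate; tabulate∘lookup; tabulate-cong)
open import Data.Product using (_×_; _,_; proj₁; proj₂; ∃)
open import Data.Sum using (_⊎_; inj₁; inj₂)
open import Data.Empty using (⊥-elim)
open import Function using (_∘_)
open import Function.Bundles using (mk⇔)
open import Function.Definitions using (Injective)
open import Relation.Binary.Definitions using (tri<; tri≈; tri>)
open import Relation.Binary.PropositionalEquality as ≡ using (_≡_; _≢_; refl; sym; trans; cong; subst)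
open import Relation.Nullary using (¬_; Dec; yes; no)
open import Relation.Nullary.Decidable using (⌊_⌋; T?)
open import Level using (0ℓ)
open import Relation.Binary.Bundles using (Poset)
open import Relation.Binary.Structures using (IsTotalOrder)
import Relation.Binary.Reasoning.Setoid as ≈-Reasoning
import Relation.Binary.Reasoning.PartialOrder as ≤-Reasoning
import Algebra.Properties.Ring as RingProperties
import Algebra.Properties.CommutativeSemigroup as CommSemigroupProperties

isYes⇒ : ∀ {A : Set} (a? : Dec A) → ⌊ a? ⌋ ≡ true → A
isYes⇒ (yes a) _ = a

⇒isYes : ∀ {A : Set} (a? : Dec A) → A → ⌊ a? ⌋ ≡ true
⇒isYes (yes _) _ = refl
⇒isYes (no ¬a) a = ⊥-elim (¬a a)

∧-true⁻ : ∀ {x y} → x ∧ y ≡ true → x ≡ true × y ≡ true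
∧-true⁻ {true} {true} _ = refl , refl

∧-true⁺ : ∀ {x y} → x ≡ true → y ≡ true → x ∧ y ≡ true
∧-true⁺ refl refl = refl

∨-true⁻ : ∀ {x y} → x ∨ y ≡ true → x ≡ true ⊎ y ≡ true
∨-true⁻ {true} _ = inj₁ refl
∨-true⁻ {false} p = inj₂ p

∨-trueˡ : ∀ {x} y → x ≡ true → x ∨ y ≡ true
∨-trueˡ y refl = refl

∨-trueʳ : ∀ x {y} → y ≡ true → x ∨ y ≡ true
∨-trueʳ true _ = refl
∨-trueʳ false p = p

true≢false : ∀ {x} → x ≡ true → x ≢ false
true≢false refl ()

not-true⁻ : ∀ {x} → not x ≡ true → x ≡ false
not-true⁻ {false} _ = refl

all-true⁻ : ∀ {A : Set} (p : A → Bool) xs → all p xs ≡ true → ∀ {x} → x ∈ xs → p x ≡ true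
all-true⁻ p (y ∷ xs) h (here refl) = proj₁ (∧-true⁻ h)
all-true⁻ p (y ∷ xs) h (there x∈xs) = all-true⁻ p xs (proj₂ (∧-true⁻ {p y} h)) x∈xs

all-true⁺ : ∀ {A : Set} (p : A → Bool) xs → (∀ {x} → x ∈ xs → p x ≡ true) → all p xs ≡ true
all-true⁺ p [] h = refl
all-true⁺ p (y ∷ xs) h = ∧-true⁺ (h (here refl)) (all-true⁺ p xs (h ∘ there))

any-true⁻ : ∀ {A : Set} (p : A → Bool) xs → any p xs ≡ true → ∃ λ x → x ∈ xs × p x ≡ true
any-true⁻ p (y ∷ xs) h with p y in eq
... | true = y , here refl , eq
... | false = let x , x∈xs , px = any-true⁻ p xs h in x , there x∈xs , px

any-true⁺ : ∀ {A : Set} (p : A → Bool) xs {x} → x ∈ xs → p x ≡ true → any p xs ≡ true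
any-true⁺ p (y ∷ xs) (here refl) px = ∨-trueˡ _ px
any-true⁺ p (y ∷ xs) (there x∈xs) px = ∨-trueʳ (p y) (any-true⁺ p xs x∈xs px)

length-filterᵇ-∈ : ∀ {A : Set} (g : A → Bool) xs {x} → x ∈ xs → g x ≡ true →
                   ∃ λ m → length (filterᵇ g xs) ≡ suc m
length-filterᵇ-∈ g (y ∷ xs) (here refl) gx rewrite gx = _ , refl
length-filterᵇ-∈ g (y ∷ xs) (there x∈xs) gx with g y
... | true = _ , refl
... | false = length-filterᵇ-∈ g xs x∈xs gx

length-filterᵇ≢0 : ∀ {A : Set} (g : A → Bool) xs → ⌊ length (filterᵇ g xs) ℕ.≟ 0 ⌋ ≡ false →
                   ∃ λ x → x ∈ xs × g x ≡ true
length-filterᵇ≢0 g (y ∷ xs) h with g y in eq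
... | true = y , here refl , eq
... | false = let x , x∈xs , gx = length-filterᵇ≢0 g xs h in x , there x∈xs , gx

tabulate-suc : ∀ k → L.tabulate {n = k} F.suc ≡ map F.suc (allFin k)
tabulate-suc k = sym (map-tabulate (λ i → i) F.suc)

all-allFin-suc : ∀ {k} (g : Fin (suc k) → Bool) → all g (allFin (suc k)) ≡ g F.zero ∧ all (g ∘ F.suc) (allFin k)
all-allFin-suc {k} g =
  trans (cong (λ xs → g F.zero ∧ all g xs) (tabulate-suc k)) (cong (λ bs → g F.zero ∧ and bs) (sym (map-∘ (allFin k))))

length-filterᵇ-map : ∀ {A B : Set} (g : B → Bool) (f : A → B) xs →
                     length (filterᵇ g (map f xs)) ≡ length (filterᵇ (g ∘ f) xs)
length-filterᵇ-map g f [] = refl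
length-filterᵇ-map g f (x ∷ xs) with g (f x)
... | true = cong suc (length-filterᵇ-map g f xs)
... | false = length-filterᵇ-map g f xs

length-filterᵇ-allFin-suc : ∀ {k} (g : Fin (suc k) → Bool) →
  length (filterᵇ g (allFin (suc k))) ≡ (if g F.zero then suc else λ c → c) (length (filterᵇ (g ∘ F.suc) (allFin k)))
length-filterᵇ-allFin-suc {k} g with g F.zero
... | true = cong suc (trans (cong (length ∘ filterᵇ g) (tabulate-suc k)) (length-filterᵇ-map g F.suc (allFin k)))
... | false = trans (cong (length ∘ filterᵇ g) (tabulate-suc k)) (length-filterᵇ-map g F.suc (allFin k))

eqFin⇒≡ : ∀ {n} {i j : Fin n} → eqFin i j ≡ true → i ≡ j
eqFin⇒≡ {i = i} {j} = isYes⇒ (i F.≟ j)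

≡⇒eqFin : ∀ {n} {i j : Fin n} → i ≡ j → eqFin i j ≡ true
≡⇒eqFin {i = i} {j} = ⇒isYes (i F.≟ j)

eqSubset⇒≡ : ∀ {n} {S T : Subset n} → eqSubset S T ≡ true → S ≡ T
eqSubset⇒≡ {S = S} {T} = isYes⇒ (≡-dec B._≟_ S T)

≡⇒eqSubset : ∀ {n} {S T : Subset n} → S ≡ T → eqSubset S T ≡ true
≡⇒eqSubset {S = S} {T} = ⇒isYes (≡-dec B._≟_ S T)

eqFin-suc : ∀ {n} (i j : Fin n) → eqFin (F.suc i) (F.suc j) ≡ eqFin i j
eqFin-suc i j = BP.⇔→≡ (mk⇔ (≡⇒eqFin ∘ FinP.suc-injective ∘ eqFin⇒≡) (≡⇒eqFin ∘ cong F.suc ∘ eqFin⇒≡))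

eqSubset-sym : ∀ {n} (S T : Subset n) → eqSubset S T ≡ eqSubset T S
eqSubset-sym S T = BP.⇔→≡ (mk⇔ (≡⇒eqSubset ∘ sym ∘ eqSubset⇒≡) (≡⇒eqSubset ∘ sym ∘ eqSubset⇒≡))

eqSubset-∷ : ∀ {n} a b (S T : Subset n) → eqSubset (a V.∷ S) (b V.∷ T) ≡ ⌊ a B.≟ b ⌋ ∧ eqSubset S T
eqSubset-∷ a b S T = BP.⇔→≡ (mk⇔ to from)
  where
  to : eqSubset (a V.∷ S) (b V.∷ T) ≡ true → ⌊ a B.≟ b ⌋ ∧ eqSubset S T ≡ true
  to h with eqSubset⇒≡ {S = a V.∷ S} {T = b V.∷ T} h
  ... | refl = ∧-true⁺ (⇒isYes (a B.≟ a) refl) (≡⇒eqSubset {S = S} refl)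
  from : ⌊ a B.≟ b ⌋ ∧ eqSubset S T ≡ true → eqSubset (a V.∷ S) (b V.∷ T) ≡ true
  from h with ∧-true⁻ {⌊ a B.≟ b ⌋} h
  ... | a≟b , S≟T with isYes⇒ (a B.≟ b) a≟b | eqSubset⇒≡ {S = S} {T = T} S≟T
  ... | refl | refl = ≡⇒eqSubset {S = a V.∷ S} refl

injectiveᵇ⇒ : ∀ {k n} (φ : Vec (Fin n) k) → injectiveᵇ φ ≡ true → Injective _≡_ _≡_ (V.lookup φ)
injectiveᵇ⇒ {k} φ h {i} {j} φi≡φj
  with ∨-true⁻ (all-true⁻ _ (allFin k) (all-true⁻ _ (allFin k) h (∈-allFin i)) (∈-allFin j))
... | inj₁ φi≢φj = ⊥-elim (true≢false (≡⇒eqFin φi≡φj) (not-true⁻ φi≢φj))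
... | inj₂ i≡j = eqFin⇒≡ i≡j

⇒injectiveᵇ : ∀ {k n} (φ : Vec (Fin n) k) → Injective _≡_ _≡_ (V.lookup φ) → injectiveᵇ φ ≡ true
⇒injectiveᵇ {k} φ inj = all-true⁺ _ (allFin k) λ {i} _ → all-true⁺ _ (allFin k) λ {j} _ → pair i j
  where
  pair : ∀ i j → (not (eqFin (V.lookup φ i) (V.lookup φ j)) ∨ eqFin i j) ≡ true
  pair i j with eqFin (V.lookup φ i) (V.lookup φ j) in eq
  ... | true = ≡⇒eqFin (inj (eqFin⇒≡ eq))
  ... | false = refl

lookup-image : ∀ {k n} (φ : Vec (Fin n) k) (S : Subset k) y →
               V.lookup (image φ S) y ≡ any (λ x → V.lookup S x ∧ eqFin (V.lookup φ x) y) (allFin k)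
lookup-image {k} φ S y = lookup∘tabulate _ y

image⁻ : ∀ {k n} (φ : Vec (Fin n) k) (S : Subset k) y → V.lookup (image φ S) y ≡ true →
         ∃ λ x → V.lookup S x ≡ true × V.lookup φ x ≡ y
image⁻ {k} φ S y h
  with any-true⁻ _ (allFin k) (trans (sym (lookup-image φ S y)) h)
... | x , _ , q = x , proj₁ (∧-true⁻ q) , eqFin⇒≡ (proj₂ (∧-true⁻ {V.lookup S x} q))

image⁺ : ∀ {k n} (φ : Vec (Fin n) k) (S : Subset k) x → V.lookup S x ≡ true →
         V.lookup (image φ S) (V.lookup φ x) ≡ true
image⁺ {k} φ S x h =
  trans (lookup-image φ S _) (any-true⁺ _ (allFin k) (∈-allFin x) (∧-true⁺ h (≡⇒eqFin refl)))

image-≡⁻ : ∀ {k n} (φ ψ : Vec (Fin n) k) S → image φ S ≡ image ψ S → ∀ x → V.lookup S x ≡ true →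
           ∃ λ y → V.lookup S y ≡ true × V.lookup φ y ≡ V.lookup ψ x
image-≡⁻ φ ψ S φS≡ψS x x∈S =
  image⁻ φ S (V.lookup ψ x) (subst (λ T → V.lookup T (V.lookup ψ x) ≡ true) (sym φS≡ψS) (image⁺ ψ S x x∈S))

∈-allVecs : ∀ {A : Set} (xs : List A) {k} (v : Vec A k) → (∀ i → V.lookup v i ∈ xs) → v ∈ allVecs xs k
∈-allVecs xs V.[] h = here refl
∈-allVecs xs (x V.∷ v) h =
  ∈-concatMap⁺ _ (lose (h F.zero) (∈-map⁺ (x V.∷_) (∈-allVecs xs v (h ∘ F.suc))))

SameEdge : ∀ {n} → Fin n × Fin n → Fin n × Fin n → Set
SameEdge (a , b) (c , d) = (a ≡ c × b ≡ d) ⊎ (a ≡ d × b ≡ c)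

sameEdge⇒SameEdge : ∀ {n} (e f : Fin n × Fin n) → sameEdge e f ≡ true → SameEdge e f
sameEdge⇒SameEdge (a , b) (c , d) h with ∨-true⁻ h
... | inj₁ q = inj₁ (eqFin⇒≡ (proj₁ (∧-true⁻ q)) , eqFin⇒≡ (proj₂ (∧-true⁻ q)))
... | inj₂ q = inj₂ (eqFin⇒≡ (proj₁ (∧-true⁻ q)) , eqFin⇒≡ (proj₂ (∧-true⁻ q)))

SameEdge⇒sameEdge : ∀ {n} (e f : Fin n × Fin n) → SameEdge e f → sameEdge e f ≡ true
SameEdge⇒sameEdge (a , b) (c , d) (inj₁ (p , q)) = ∨-trueˡ _ (∧-true⁺ (≡⇒eqFin p) (≡⇒eqFin q))
SameEdge⇒sameEdge (a , b) (c , d) (inj₂ (p , q)) = ∨-trueʳ _ (∧-true⁺ (≡⇒eqFin p) (≡⇒eqFin q))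

sameEdge≡false⇒¬SameEdge : ∀ {n} (e f : Fin n × Fin n) → sameEdge e f ≡ false → ¬ SameEdge e f
sameEdge≡false⇒¬SameEdge e f h se = true≢false (SameEdge⇒sameEdge e f se) h

SameEdge-refl : ∀ {n} {e : Fin n × Fin n} → SameEdge e e
SameEdge-refl = inj₁ (refl , refl)

SameEdge-sym : ∀ {n} {e f : Fin n × Fin n} → SameEdge e f → SameEdge f e
SameEdge-sym (inj₁ (p , q)) = inj₁ (sym p , sym q)
SameEdge-sym (inj₂ (p , q)) = inj₂ (sym q , sym p)

SameEdge-trans : ∀ {n} {e f g : Fin n × Fin n} → SameEdge e f → SameEdge f g → SameEdge e g
SameEdge-trans (inj₁ (refl , refl)) q = q
SameEdge-trans (inj₂ (refl , refl)) (inj₁ (refl , refl)) = inj₂ (refl , refl)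
SameEdge-trans (inj₂ (refl , refl)) (inj₂ (refl , refl)) = SameEdge-refl

SameEdge-map : ∀ {m n} (f : Fin m → Fin n) {a b c d} →
               SameEdge (a , b) (c , d) → SameEdge (f a , f b) (f c , f d)
SameEdge-map f (inj₁ (refl , refl)) = SameEdge-refl
SameEdge-map f (inj₂ (refl , refl)) = inj₂ (refl , refl)

SameEdge-unmap : ∀ {m n} {f : Fin m → Fin n} → Injective _≡_ _≡_ f → ∀ {a b c d} →
                 SameEdge (f a , f b) (f c , f d) → SameEdge (a , b) (c , d)
SameEdge-unmap inj (inj₁ (p , q)) = inj₁ (inj p , inj q)
SameEdge-unmap inj (inj₂ (p , q)) = inj₂ (inj p , inj q)

Endpoint : ∀ {m} → Fin m → Fin m × Fin m → Set
Endpoint y e = proj₁ e ≡ y ⊎ proj₂ e ≡ y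

SameEdge-endpoints : ∀ {n} {a b : Fin n} e → SameEdge (a , b) e →
                     Endpoint a e × Endpoint b e
SameEdge-endpoints e (inj₁ (p , q)) = inj₁ (sym p) , inj₂ (sym q)
SameEdge-endpoints e (inj₂ (p , q)) = inj₂ (sym p) , inj₁ (sym q)

∈-pairs : ∀ {n} {a b : Fin n} → a F.< b → (a , b) ∈ pairs n
∈-pairs {n} {a} {b} a<b = ∈-filter⁺ (λ e → toℕ (proj₁ e) ℕ.<? toℕ (proj₂ e))
  (∈-concatMap⁺ (λ i → map (i ,_) (allFin n)) (lose (∈-allFin a) (∈-map⁺ (a ,_) (∈-allFin b)))) a<b

pairs-complete : ∀ {n} (x y : Fin n) → x ≢ y → ∃ λ e → e ∈ pairs n × SameEdge (x , y) e
pairs-complete x y x≢y with FinP.<-cmp x y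
... | tri< x<y _ _ = (x , y) , ∈-pairs x<y , SameEdge-refl
... | tri≈ _ x≡y _ = ⊥-elim (x≢y x≡y)
... | tri> _ _ y<x = (y , x) , ∈-pairs y<x , inj₂ (refl , refl)

module _ {n : ℕ} where
  private Edge = Fin n × Fin n

  Distinct : List Edge → Set
  Distinct = AllPairs (λ e f → ¬ SameEdge e f)

  infix 4 _⊆ₑ_
  _⊆ₑ_ : List Edge → List Edge → Set
  A ⊆ₑ B = All (λ e → Any (SameEdge e) B) A

  multiplicity : Edge → List Edge → ℕ
  multiplicity e = length ∘ filterᵇ (sameEdge e)

  deleteEdge : Edge → List Edge → List Edge
  deleteEdge e = filterᵇ (not ∘ sameEdge e)

  ⊆ₑ-[] : ∀ {A} → A ⊆ₑ [] → A ≡ []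
  ⊆ₑ-[] All.[] = refl

  deleteEdge-⊆ₑ : ∀ e {es} L → L ⊆ₑ e ∷ es → deleteEdge e L ⊆ₑ es
  deleteEdge-⊆ₑ e [] _ = All.[]
  deleteEdge-⊆ₑ e (q ∷ L) (h All.∷ hs) with sameEdge e q in eq
  ... | true = deleteEdge-⊆ₑ e L hs
  ... | false with h
  ... | here q~e = ⊥-elim (sameEdge≡false⇒¬SameEdge e q eq (SameEdge-sym q~e))
  ... | there q∈es = q∈es All.∷ deleteEdge-⊆ₑ e L hs

  All-deleteEdge⁻ : ∀ {P : Edge → Set} e L →
                    All (λ q → SameEdge e q → P q) L → All P (deleteEdge e L) → All P L
  All-deleteEdge⁻ e [] _ _ = All.[]
  All-deleteEdge⁻ e (q ∷ L) (f All.∷ fs) h with sameEdge e q in eq | h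
  ... | true  | h′ = f (sameEdge⇒SameEdge e q eq) All.∷ All-deleteEdge⁻ e L fs h′
  ... | false | hq All.∷ h′ = hq All.∷ All-deleteEdge⁻ e L fs h′

  ⊆ₑ-deleteEdge⁻ : ∀ e {A B} → All (λ q → SameEdge e q → Any (SameEdge q) B) A →
                   deleteEdge e A ⊆ₑ deleteEdge e B → A ⊆ₑ B
  ⊆ₑ-deleteEdge⁻ e {A} e∈A⇒e∈B A⊆B =
    All-deleteEdge⁻ e A e∈A⇒e∈B (All.map (AnyP.filter⁻ (T? ∘ not ∘ sameEdge e)) A⊆B)

  Distinct-deleteEdge : ∀ e {L} → Distinct L → Distinct (deleteEdge e L)
  Distinct-deleteEdge e = AllPairsP.filter⁺ (T? ∘ not ∘ sameEdge e)

  multiplicity-absent : ∀ e L → All (λ q → sameEdge e q ≡ false) L → multiplicity e L ≡ 0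
  multiplicity-absent e [] _ = refl
  multiplicity-absent e (q ∷ L) (h All.∷ hs) rewrite h = multiplicity-absent e L hs

  multiplicity-distinct : ∀ e L → Distinct L →
    (multiplicity e L ≡ 0 × All (λ q → sameEdge e q ≡ false) L) ⊎ (multiplicity e L ≡ 1 × Any (SameEdge e) L)
  multiplicity-distinct e [] _ = inj₁ (refl , All.[])
  multiplicity-distinct e (q ∷ L) (q≁L AllPairs.∷ dL) with sameEdge e q in eq
  ... | true = inj₂ (cong suc (multiplicity-absent e L (All.map absent q≁L)) , here e~q)
    where
    e~q = sameEdge⇒SameEdge e q eq
    absent : ∀ {q′} → ¬ SameEdge q q′ → sameEdge e q′ ≡ false
    absent {q′} q≁q′ with sameEdge e q′ in eq′
    ... | true = ⊥-elim (q≁q′ (SameEdge-trans (SameEdge-sym e~q) (sameEdge⇒SameEdge e q′ eq′)))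
    ... | false = refl
  ... | false with multiplicity-distinct e L dL
  ... | inj₁ (m≡0 , absent) = inj₁ (m≡0 , eq All.∷ absent)
  ... | inj₂ (m≡1 , present) = inj₂ (m≡1 , there present)

  absent⇒¬Any : ∀ {e : Edge} L → All (λ q → sameEdge e q ≡ false) L → ¬ Any (SameEdge e) L
  absent⇒¬Any (q ∷ L) (h All.∷ _) (here e~q) = sameEdge≡false⇒¬SameEdge _ q h e~q
  absent⇒¬Any (q ∷ L) (_ All.∷ hs) (there e∈L) = absent⇒¬Any L hs e∈L

  multiplicity-cong : ∀ {e f : Edge} {L} → Distinct L →
                      (Any (SameEdge e) L → Any (SameEdge f) L) → (Any (SameEdge f) L → Any (SameEdge e) L) →
                      multiplicity e L ≡ multiplicity f L
  multiplicity-cong {e = e} {f} {L} distinct e⇒f f⇒e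
    with multiplicity-distinct e L distinct | multiplicity-distinct f L distinct
  ... | inj₁ (e0 , _)        | inj₁ (f0 , _)        = trans e0 (sym f0)
  ... | inj₂ (e1 , _)        | inj₂ (f1 , _)        = trans e1 (sym f1)
  ... | inj₁ (_ , e-absent)  | inj₂ (_ , f∈L)       = ⊥-elim (absent⇒¬Any L e-absent (f⇒e f∈L))
  ... | inj₂ (_ , e∈L)       | inj₁ (_ , f-absent)  = ⊥-elim (absent⇒¬Any L f-absent (e⇒f e∈L))

-- Isolated vertices and the automorphism φ⁻¹ ∘ ψ

mapEdge : ∀ {m n} → (Fin m → Fin n) → Fin m × Fin m → Fin n × Fin n
mapEdge f e = (f (proj₁ e) , f (proj₂ e))

edgeImage : ∀ {n} (α : Shape) → Vec (Fin n) (k α) → List (Fin n × Fin n)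
edgeImage α φ = map (mapEdge (V.lookup φ)) (E α)

edgeImage-⊆ₑ-pairs : ∀ {n} (α : Shape) (φ : Vec (Fin n) (k α)) → injectiveᵇ φ ≡ true →
                     edgeImage α φ ⊆ₑ pairs n
edgeImage-⊆ₑ-pairs α φ φ-inj = AllP.map⁺ (All.map covered (loopless α))
  where
  covered : ∀ {e} → proj₁ e ≢ proj₂ e → Any (SameEdge _) (pairs _)
  covered a≢b = let _ , e∈pairs , e~ = pairs-complete _ _ (a≢b ∘ injectiveᵇ⇒ φ φ-inj) in lose e∈pairs e~

Proper⇒Distinct : (α : Shape) → Proper α → Distinct (E α)
Proper⇒Distinct α = AllPairs.map (λ {e} {f} → sameEdge≡false⇒¬SameEdge e f)

edgeImage-distinct : ∀ {n} (α : Shape) (φ : Vec (Fin n) (k α)) → injectiveᵇ φ ≡ true → Proper α →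
                     Distinct (edgeImage α φ)
edgeImage-distinct α φ φ-inj proper =
  AllPairsP.map⁺ (AllPairs.map (λ e≁f → e≁f ∘ SameEdge-unmap (injectiveᵇ⇒ φ φ-inj)) (Proper⇒Distinct α proper))

selectsᵇ : ∀ {n} (α : Shape) → Vec (Fin n) (k α) → Subset n → Subset n → Bool
selectsᵇ α φ S T = injectiveᵇ φ ∧ eqSubset (image φ (U α)) S ∧ eqSubset (image φ (V α)) T

compatibleᵇ : ∀ {n} (α : Shape) → Vec (Fin n) (k α) → Vec (Fin n) (k α) → Bool
compatibleᵇ α φ ψ =
  (injectiveᵇ φ ∧ injectiveᵇ ψ) ∧ eqSubset (image φ (U α)) (image ψ (U α)) ∧ eqSubset (image φ (V α)) (image ψ (V α))

compatibleᵇ⇒ : ∀ {n} (α : Shape) (φ ψ : Vec (Fin n) (k α)) → compatibleᵇ α φ ψ ≡ true →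
  injectiveᵇ φ ≡ true × injectiveᵇ ψ ≡ true × image φ (U α) ≡ image ψ (U α) × image φ (V α) ≡ image ψ (V α)
compatibleᵇ⇒ α φ ψ h =
  let injs , images = ∧-true⁻ {injectiveᵇ φ ∧ injectiveᵇ ψ} h
      iφ , iψ = ∧-true⁻ {injectiveᵇ φ} injs
      eU , eV = ∧-true⁻ {eqSubset (image φ (U α)) (image ψ (U α))} images
  in iφ , iψ , eqSubset⇒≡ eU , eqSubset⇒≡ eV

isolatedᵇ : (α : Shape) → Fin (k α) → Bool
isolatedᵇ α x = not (V.lookup (U α) x ∨ V.lookup (V α) x) ∧ ⌊ degree α x ℕ.≟ 0 ⌋

edge⇒¬isolated : (α : Shape) {e : Fin (k α) × Fin (k α)} → e ∈ E α → ∀ {y} → Endpoint y e →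
                 isolatedᵇ α y ≡ false
edge⇒¬isolated α {e} e∈E {y} y∈e
  with length-filterᵇ-∈ (λ e → eqFin (proj₁ e) y ∨ eqFin (proj₂ e) y) (E α) e∈E (incident y∈e)
  where
  incident : Endpoint y e → (eqFin (proj₁ e) y ∨ eqFin (proj₂ e) y) ≡ true
  incident (inj₁ q) = ∨-trueˡ _ (≡⇒eqFin q)
  incident (inj₂ q) = ∨-trueʳ _ (≡⇒eqFin q)
... | _ , deg≡suc rewrite deg≡suc = BP.∧-zeroʳ _

U⇒¬isolated : (α : Shape) (y : Fin (k α)) → V.lookup (U α) y ≡ true → isolatedᵇ α y ≡ false
U⇒¬isolated α y h rewrite h = refl

V⇒¬isolated : (α : Shape) (y : Fin (k α)) → V.lookup (V α) y ≡ true → isolatedᵇ α y ≡ false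
V⇒¬isolated α y h rewrite h | BP.∨-zeroʳ (V.lookup (U α) y) = refl

¬isolated⇒ : (α : Shape) (x : Fin (k α)) → isolatedᵇ α x ≡ false →
             V.lookup (U α) x ≡ true ⊎ V.lookup (V α) x ≡ true ⊎ ∃ λ e → e ∈ E α × Endpoint x e
¬isolated⇒ α x h with V.lookup (U α) x in x∈U
... | true = inj₁ refl
... | false with V.lookup (V α) x in x∈V
... | true = inj₂ (inj₁ refl)
... | false with length-filterᵇ≢0 (λ e → eqFin (proj₁ e) x ∨ eqFin (proj₂ e) x) (E α) h
... | e , e∈E , incident with ∨-true⁻ incident
... | inj₁ q = inj₂ (inj₂ (e , e∈E , inj₁ (eqFin⇒≡ q)))
... | inj₂ q = inj₂ (inj₂ (e , e∈E , inj₂ (eqFin⇒≡ q)))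

Endpoint-SameEdge : ∀ {m n} {f g : Fin m → Fin n} {e e′ x} →
                    SameEdge (mapEdge f e) (mapEdge g e′) → Endpoint x e → ∃ λ y → Endpoint y e′ × g y ≡ f x
Endpoint-SameEdge (inj₁ (p , q)) (inj₁ refl) = _ , inj₁ refl , sym p
Endpoint-SameEdge (inj₁ (p , q)) (inj₂ refl) = _ , inj₂ refl , sym q
Endpoint-SameEdge (inj₂ (p , q)) (inj₁ refl) = _ , inj₂ refl , sym p
Endpoint-SameEdge (inj₂ (p , q)) (inj₂ refl) = _ , inj₁ refl , sym q

⊆ₑ-edgeImage⁻ : ∀ {n} (α : Shape) {φ ψ : Vec (Fin n) (k α)} → edgeImage α φ ⊆ₑ edgeImage α ψ →
                ∀ {e} → e ∈ E α → ∃ λ e′ → e′ ∈ E α × SameEdge (mapEdge (V.lookup φ) e) (mapEdge (V.lookup ψ) e′)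
⊆ₑ-edgeImage⁻ α φ⊆ψ e∈E = find (AnyP.map⁻ (All.lookup φ⊆ψ (∈-map⁺ _ e∈E)))

isAutᵇ⁺ : (α : Shape) (σ : Vec (Fin (k α)) (k α)) → Injective _≡_ _≡_ (V.lookup σ) →
          image σ (U α) ≡ U α → image σ (V α) ≡ V α →
          (∀ a b → mult α a b ≡ mult α (V.lookup σ a) (V.lookup σ b)) → isAutᵇ α σ ≡ true
isAutᵇ⁺ α σ σ-inj σU≡U σV≡V mult-eq =
  ∧-true⁺ (⇒injectiveᵇ σ σ-inj) (∧-true⁺ (≡⇒eqSubset σU≡U) (∧-true⁺ (≡⇒eqSubset σV≡V)
    (all-true⁺ _ (allFin (k α)) λ {a} _ → all-true⁺ _ (allFin (k α)) λ {b} _ → ⇒isYes (_ ℕ.≟ _) (mult-eq a b))))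

agreesOffIsolatedᵇ : ∀ {n} (α : Shape) → (ψ φ : Vec (Fin n) (k α)) → Vec (Fin (k α)) (k α) → Bool
agreesOffIsolatedᵇ α ψ φ σ =
  all (λ x → isolatedᵇ α x ∨ eqFin (V.lookup ψ x) (V.lookup φ (V.lookup σ x))) (allFin (k α))

module EqualEdgeImages (α : Shape) (proper : Proper α) {n : ℕ} (φ ψ : Vec (Fin n) (k α))
  (φ-inj : injectiveᵇ φ ≡ true) (ψ-inj : injectiveᵇ ψ ≡ true)
  (φU≡ψU : image φ (U α) ≡ image ψ (U α)) (φV≡ψV : image φ (V α) ≡ image ψ (V α))
  (φ⊆ψ : edgeImage α φ ⊆ₑ edgeImage α ψ) (ψ⊆φ : edgeImage α ψ ⊆ₑ edgeImage α φ) where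

  private
    φ′ ψ′ : Fin (k α) → Fin n
    φ′ = V.lookup φ
    ψ′ = V.lookup ψ

    isolated : Fin (k α) → Bool
    isolated = isolatedᵇ α

  φ-hits-¬isolated : ∀ x → isolated x ≡ false → ∃ λ y → φ′ y ≡ ψ′ x × isolated y ≡ false
  φ-hits-¬isolated x h with ¬isolated⇒ α x h
  ... | inj₁ x∈U = let y , y∈U , φy≡ψx = image-≡⁻ φ ψ (U α) φU≡ψU x x∈U in y , φy≡ψx , U⇒¬isolated α y y∈U
  ... | inj₂ (inj₁ x∈V) = let y , y∈V , φy≡ψx = image-≡⁻ φ ψ (V α) φV≡ψV x x∈V in y , φy≡ψx , V⇒¬isolated α y y∈V
  ... | inj₂ (inj₂ (e , e∈E , x∈e)) =
    let e′ , e′∈E , ψe~φe′ = ⊆ₑ-edgeImage⁻ α {ψ} {φ} ψ⊆φ e∈E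
        y , y∈e′ , φy≡ψx = Endpoint-SameEdge {f = ψ′} {g = φ′} ψe~φe′ x∈e
    in y , φy≡ψx , edge⇒¬isolated α e′∈E y∈e′

  preimage : Fin (k α) → Fin (k α)
  preimage x with FinP.any? (λ y → φ′ y F.≟ ψ′ x)
  ... | yes (y , _) = y
  ... | no _ = x  -- never reached off I_α, by φ-hits-¬isolated

  preimage-unique : ∀ {x y} → φ′ y ≡ ψ′ x → preimage x ≡ y
  preimage-unique {x} {y} φy≡ψx with FinP.any? (λ y → φ′ y F.≟ ψ′ x)
  ... | yes (y′ , φy′≡ψx) = injectiveᵇ⇒ φ φ-inj (trans φy′≡ψx (sym φy≡ψx))
  ... | no ∄y = ⊥-elim (∄y (y , φy≡ψx))

  σ′ : Fin (k α) → Fin (k α)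
  σ′ x = if isolated x then x else preimage x

  σ : Vec (Fin (k α)) (k α)
  σ = V.tabulate σ′

  σ-isolated : ∀ {x} → isolated x ≡ true → σ′ x ≡ x
  σ-isolated h rewrite h = refl

  σ-¬isolated : ∀ {x} → isolated x ≡ false → φ′ (σ′ x) ≡ ψ′ x × isolated (σ′ x) ≡ false
  σ-¬isolated {x} h with φ-hits-¬isolated x h
  ... | y , φy≡ψx , y-¬isolated rewrite h | preimage-unique φy≡ψx = φy≡ψx , y-¬isolated

  σ-injective : Injective _≡_ _≡_ σ′
  σ-injective {i} {j} σi≡σj = by-cases (isolated i) (isolated j) refl refl
    where
    by-cases : ∀ bi bj → isolated i ≡ bi → isolated j ≡ bj → i ≡ j
    by-cases true  true  ei ej = trans (sym (σ-isolated ei)) (trans σi≡σj (σ-isolated ej))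
    by-cases true  false ei ej = ⊥-elim (true≢false ei
      (trans (cong isolated (trans (sym (σ-isolated ei)) σi≡σj)) (proj₂ (σ-¬isolated ej))))
    by-cases false true  ei ej = ⊥-elim (true≢false ej
      (trans (cong isolated (trans (sym (σ-isolated ej)) (sym σi≡σj))) (proj₂ (σ-¬isolated ei))))
    by-cases false false ei ej = injectiveᵇ⇒ ψ ψ-inj
      (trans (sym (proj₁ (σ-¬isolated ei))) (trans (cong φ′ σi≡σj) (proj₁ (σ-¬isolated ej))))

  σ-edge⇒¬isolated : ∀ {x e} → e ∈ E α → Endpoint (σ′ x) e → isolated x ≡ false
  σ-edge⇒¬isolated {x} e∈E σx∈e with isolated x in ex
  ... | true = ⊥-elim (true≢false ex (edge⇒¬isolated α e∈E σx∈e))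
  ... | false = refl

  σ-lookup : ∀ x → V.lookup σ x ≡ σ′ x
  σ-lookup = lookup∘tabulate σ′

  σ-fixes : ∀ S → (∀ y → V.lookup S y ≡ true → isolated y ≡ false) → image φ S ≡ image ψ S → image σ S ≡ S
  σ-fixes S S-¬isolated φS≡ψS = trans (tabulate-cong member) (tabulate∘lookup S)
    where
    member : ∀ y → any (λ x → V.lookup S x ∧ eqFin (V.lookup σ x) y) (allFin (k α)) ≡ V.lookup S y
    member y = BP.⇔→≡ (mk⇔ to from)
      where
      to : any (λ x → V.lookup S x ∧ eqFin (V.lookup σ x) y) (allFin (k α)) ≡ true → V.lookup S y ≡ true
      to h with any-true⁻ _ (allFin (k α)) h
      ... | x , _ , x∈S∧σx≡y with ∧-true⁻ x∈S∧σx≡y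
      ... | x∈S , σx≡y with image-≡⁻ φ ψ S φS≡ψS x x∈S
      ... | z , z∈S , φz≡ψx = subst (λ w → V.lookup S w ≡ true) z≡y z∈S
        where
        z≡y : z ≡ y
        z≡y = trans (injectiveᵇ⇒ φ φ-inj (trans φz≡ψx (sym (proj₁ (σ-¬isolated (S-¬isolated x x∈S))))))
                    (trans (sym (σ-lookup x)) (eqFin⇒≡ σx≡y))
      from : V.lookup S y ≡ true → any (λ x → V.lookup S x ∧ eqFin (V.lookup σ x) y) (allFin (k α)) ≡ true
      from y∈S with image-≡⁻ ψ φ S (sym φS≡ψS) y y∈S
      ... | x , x∈S , ψx≡φy = any-true⁺ _ (allFin (k α)) (∈-allFin x) (∧-true⁺ x∈S (≡⇒eqFin σx≡y))
        where
        σx≡y : V.lookup σ x ≡ y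
        σx≡y = trans (σ-lookup x)
                 (injectiveᵇ⇒ φ φ-inj (trans (proj₁ (σ-¬isolated (S-¬isolated x x∈S))) ψx≡φy))

  σ-preserves-edges : ∀ {a b} → Any (SameEdge (a , b)) (E α) → Any (SameEdge (σ′ a , σ′ b)) (E α)
  σ-preserves-edges ab∈E with find ab∈E
  ... | e , e∈E , ab~e =
    let a∈e , b∈e = SameEdge-endpoints e ab~e
        e′ , e′∈E , ψe~φe′ = ⊆ₑ-edgeImage⁻ α {ψ} {φ} ψ⊆φ e∈E
        φσa≡ψa = proj₁ (σ-¬isolated (edge⇒¬isolated α e∈E a∈e))
        φσb≡ψb = proj₁ (σ-¬isolated (edge⇒¬isolated α e∈E b∈e))
        ψab~φe′ = SameEdge-trans (SameEdge-map ψ′ ab~e) ψe~φe′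
    in lose e′∈E (SameEdge-unmap (injectiveᵇ⇒ φ φ-inj)
                   (subst (λ v → SameEdge v _) (sym (≡.cong₂ _,_ φσa≡ψa φσb≡ψb)) ψab~φe′))

  σ-reflects-edges : ∀ {a b} → Any (SameEdge (σ′ a , σ′ b)) (E α) → Any (SameEdge (a , b)) (E α)
  σ-reflects-edges σab∈E with find σab∈E
  ... | e , e∈E , σab~e =
    let σa∈e , σb∈e = SameEdge-endpoints e σab~e
        e′ , e′∈E , φe~ψe′ = ⊆ₑ-edgeImage⁻ α {φ} {ψ} φ⊆ψ e∈E
        φσa≡ψa = proj₁ (σ-¬isolated (σ-edge⇒¬isolated e∈E σa∈e))
        φσb≡ψb = proj₁ (σ-¬isolated (σ-edge⇒¬isolated e∈E σb∈e))
        φσab~ψe′ = SameEdge-trans (SameEdge-map φ′ σab~e) φe~ψe′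
    in lose e′∈E (SameEdge-unmap (injectiveᵇ⇒ ψ ψ-inj)
                   (subst (λ v → SameEdge v _) (≡.cong₂ _,_ φσa≡ψa φσb≡ψb) φσab~ψe′))

  σ-automorphism : isAutᵇ α σ ≡ true
  σ-automorphism = isAutᵇ⁺ α σ
    (λ σi≡σj → σ-injective (trans (sym (σ-lookup _)) (trans σi≡σj (σ-lookup _))))
    (σ-fixes (U α) (U⇒¬isolated α) φU≡ψU) (σ-fixes (V α) (V⇒¬isolated α) φV≡ψV)
    (λ a b → trans (multiplicity-cong (Proper⇒Distinct α proper) σ-preserves-edges σ-reflects-edges)
                   (sym (≡.cong₂ (mult α) (σ-lookup a) (σ-lookup b))))

  σ-agrees : agreesOffIsolatedᵇ α ψ φ σ ≡ true
  σ-agrees = all-true⁺ _ (allFin (k α)) λ {x} _ → agrees x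
    where
    agrees : ∀ x → (isolated x ∨ eqFin (ψ′ x) (φ′ (V.lookup σ x))) ≡ true
    agrees x with isolated x in ex
    ... | true = refl
    ... | false = ≡⇒eqFin (sym (trans (cong φ′ (σ-lookup x)) (proj₁ (σ-¬isolated ex))))

equalEdgeImages⇒automorphism :
  (α : Shape) → Proper α → ∀ {n} (φ ψ : Vec (Fin n) (k α)) → injectiveᵇ φ ≡ true → injectiveᵇ ψ ≡ true →
  image φ (U α) ≡ image ψ (U α) → image φ (V α) ≡ image ψ (V α) →
  edgeImage α φ ⊆ₑ edgeImage α ψ → edgeImage α ψ ⊆ₑ edgeImage α φ →
  ∃ λ σ → isAutᵇ α σ ≡ true × agreesOffIsolatedᵇ α ψ φ σ ≡ true
equalEdgeImages⇒automorphism α proper φ ψ φ-inj ψ-inj φU≡ψU φV≡ψV φ⊆ψ ψ⊆φ =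
  σ , σ-automorphism , σ-agrees
  where open EqualEdgeImages α proper φ ψ φ-inj ψ-inj φU≡ψU φV≡ψV φ⊆ψ ψ⊆φ

module _ (𝔽 : OrderedField) where
  open OrderedField 𝔽 renaming (refl to ≈-refl; sym to ≈-sym; trans to ≈-trans)
  open RingProperties ring using (-‿distribˡ-*; -‿distribʳ-*; -‿involutive)
  open CommSemigroupProperties *-commutativeSemigroup using (interchange; x∙yz≈y∙xz)
  open import Algebra.Solver.CommutativeMonoid *-commutativeMonoid using (solve; _⊜_) renaming (_⊕_ to _∙_)

  -- Ordered fields and finite sums

  poset : Poset 0ℓ 0ℓ 0ℓ
  poset = record { isPartialOrder = IsTotalOrder.isPartialOrder isTotalOrder }

  open Poset poset using () renaming (refl to ≤-refl; trans to ≤-trans; antisym to ≤-antisym; reflexive to ≈⇒≤)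

  ≤-respˡ-≈ : ∀ {x y z} → x ≈ y → x ≤ z → y ≤ z
  ≤-respˡ-≈ x≈y x≤z = ≤-trans (≈⇒≤ (≈-sym x≈y)) x≤z

  ≤-respʳ-≈ : ∀ {x y z} → y ≈ z → x ≤ y → x ≤ z
  ≤-respʳ-≈ y≈z x≤y = ≤-trans x≤y (≈⇒≤ y≈z)

  +-monoʳ-≤ : ∀ {x y} z → x ≤ y → (z + x) ≤ (z + y)
  +-monoʳ-≤ {x} {y} z x≤y = ≤-respˡ-≈ (+-comm x z) (≤-respʳ-≈ (+-comm y z) (+-mono-≤ z x≤y))

  +-mono-≤₂ : ∀ {a b c d} → a ≤ b → c ≤ d → (a + c) ≤ (b + d)
  +-mono-≤₂ {b = b} {c = c} a≤b c≤d = ≤-trans (+-mono-≤ c a≤b) (+-monoʳ-≤ b c≤d)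

  +-nonneg : ∀ {a b} → 0# ≤ a → 0# ≤ b → 0# ≤ (a + b)
  +-nonneg 0≤a 0≤b = ≤-respˡ-≈ (+-identityˡ 0#) (+-mono-≤₂ 0≤a 0≤b)

  -- 1 ≤ 0 would make 0 - 1 nonnegative, and then 1 = (0 - 1)² ≥ 0.
  0≤1 : 0# ≤ 1#
  0≤1 with IsTotalOrder.total isTotalOrder 0# 1#
  ... | inj₁ 0≤1 = 0≤1
  ... | inj₂ 1≤0 = ⊥-elim (0≉1 (≤-antisym (≤-respʳ-≈ square≈1 (*-nonneg 0≤-1 0≤-1)) 1≤0))
    where
    0≤-1 : 0# ≤ (0# - 1#)
    0≤-1 = ≤-respˡ-≈ (-‿inverseʳ 1#) (+-mono-≤ (- 1#) 1≤0)
    square≈1 : (0# - 1#) * (0# - 1#) ≈ 1#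
    square≈1 = begin
      (0# - 1#) * (0# - 1#)  ≈⟨ *-cong (+-identityˡ (- 1#)) (+-identityˡ (- 1#)) ⟩
      (- 1#) * (- 1#)        ≈⟨ ≈-sym (-‿distribˡ-* 1# (- 1#)) ⟩
      - (1# * (- 1#))        ≈⟨ -‿cong (*-identityˡ (- 1#)) ⟩
      - (- 1#)               ≈⟨ -‿involutive 1# ⟩
      1#                     ∎
      where open ≈-Reasoning setoid

  ι-nonneg : ∀ m → 0# ≤ ι m
  ι-nonneg zero = ≤-refl
  ι-nonneg (suc m) = +-nonneg 0≤1 (ι-nonneg m)

  ι-+ : ∀ a b → ι (a +ℕ b) ≈ ι a + ι b
  ι-+ zero b = ≈-sym (+-identityˡ (ι b))
  ι-+ (suc a) b = ≈-trans (+-congˡ (ι-+ a b)) (≈-sym (+-assoc 1# (ι a) (ι b)))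

  ι-* : ∀ a b → ι (a *ℕ b) ≈ ι a * ι b
  ι-* zero b = ≈-sym (zeroˡ (ι b))
  ι-* (suc a) b = begin
    ι (b +ℕ a *ℕ b)    ≈⟨ ι-+ b (a *ℕ b) ⟩
    ι b + ι (a *ℕ b)   ≈⟨ +-cong (≈-sym (*-identityˡ (ι b))) (ι-* a b) ⟩
    1# * ι b + ι a * ι b ≈⟨ ≈-sym (distribʳ (ι b) 1# (ι a)) ⟩
    (1# + ι a) * ι b   ∎
    where open ≈-Reasoning setoid

  ind : Bool → Carrier
  ind true = 1#
  ind false = 0#

  ind-nonneg : ∀ b → 0# ≤ ind b
  ind-nonneg true = 0≤1
  ind-nonneg false = ≤-refl

  ind-∧ : ∀ a b → ind (a ∧ b) ≈ ind a * ind b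
  ind-∧ true b = ≈-sym (*-identityˡ (ind b))
  ind-∧ false b = ≈-sym (zeroˡ (ind b))

  if-then-0≈ind-* : ∀ b x → (if b then x else 0#) ≈ ind b * x
  if-then-0≈ind-* true x = ≈-sym (*-identityˡ x)
  if-then-0≈ind-* false x = ≈-sym (zeroˡ x)

  ≡⇒≈ : ∀ {x y} → x ≡ y → x ≈ y
  ≡⇒≈ refl = ≈-refl

  ∑ : ∀ {A : Set} → List A → (A → Carrier) → Carrier
  ∑ xs f = sumF (map f xs)

  ∑-cong : ∀ {A : Set} (xs : List A) {f g : A → Carrier} → (∀ x → f x ≈ g x) → ∑ xs f ≈ ∑ xs g
  ∑-cong [] f≈g = ≈-refl
  ∑-cong (x ∷ xs) f≈g = +-cong (f≈g x) (∑-cong xs f≈g)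

  ∑-mono : ∀ {A : Set} (xs : List A) {f g : A → Carrier} → (∀ x → f x ≤ g x) → ∑ xs f ≤ ∑ xs g
  ∑-mono [] f≤g = ≤-refl
  ∑-mono (x ∷ xs) f≤g = +-mono-≤₂ (f≤g x) (∑-mono xs f≤g)

  ∑-nonneg : ∀ {A : Set} (xs : List A) {f : A → Carrier} → (∀ x → 0# ≤ f x) → 0# ≤ ∑ xs f
  ∑-nonneg [] f≥0 = ≤-refl
  ∑-nonneg (x ∷ xs) f≥0 = +-nonneg (f≥0 x) (∑-nonneg xs f≥0)

  term≤∑ : ∀ {A : Set} (xs : List A) {f : A → Carrier} → (∀ x → 0# ≤ f x) → ∀ {x} → x ∈ xs → f x ≤ ∑ xs f
  term≤∑ (y ∷ xs) {f} f≥0 (here refl) = ≤-respˡ-≈ (+-identityʳ (f y)) (+-monoʳ-≤ (f y) (∑-nonneg xs f≥0))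
  term≤∑ (y ∷ xs) {f} f≥0 {x} (there x∈xs) = ≤-respˡ-≈ (+-identityˡ (f x)) (+-mono-≤₂ (f≥0 y) (term≤∑ xs f≥0 x∈xs))

  ∑-0 : ∀ {A : Set} (xs : List A) → ∑ xs (λ _ → 0#) ≈ 0#
  ∑-0 [] = ≈-refl
  ∑-0 (x ∷ xs) = ≈-trans (+-identityˡ _) (∑-0 xs)

  ∑-distrib-+ : ∀ {A : Set} (xs : List A) (f g : A → Carrier) → ∑ xs (λ x → f x + g x) ≈ ∑ xs f + ∑ xs g
  ∑-distrib-+ [] f g = ≈-sym (+-identityˡ 0#)
  ∑-distrib-+ (x ∷ xs) f g = ≈-trans (+-congˡ (∑-distrib-+ xs f g)) (+-interchange (f x) (g x) (∑ xs f) (∑ xs g))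
    where open CommSemigroupProperties +-commutativeSemigroup using () renaming (interchange to +-interchange)

  *-distribˡ-∑ : ∀ {A : Set} (xs : List A) c (f : A → Carrier) → c * ∑ xs f ≈ ∑ xs (λ x → c * f x)
  *-distribˡ-∑ [] c f = zeroʳ c
  *-distribˡ-∑ (x ∷ xs) c f = ≈-trans (distribˡ c (f x) (∑ xs f)) (+-congˡ (*-distribˡ-∑ xs c f))

  *-distribʳ-∑ : ∀ {A : Set} (xs : List A) c (f : A → Carrier) → ∑ xs f * c ≈ ∑ xs (λ x → f x * c)
  *-distribʳ-∑ xs c f =
    ≈-trans (*-comm (∑ xs f) c) (≈-trans (*-distribˡ-∑ xs c f) (∑-cong xs (λ x → *-comm c (f x))))

  ∑-comm : ∀ {A B : Set} (xs : List A) (ys : List B) (f : A → B → Carrier) →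
           ∑ xs (λ x → ∑ ys (f x)) ≈ ∑ ys (λ y → ∑ xs (λ x → f x y))
  ∑-comm [] ys f = ≈-sym (∑-0 ys)
  ∑-comm (x ∷ xs) ys f =
    ≈-trans (+-congˡ (∑-comm xs ys f)) (≈-sym (∑-distrib-+ ys (f x) (λ y → ∑ xs (λ x′ → f x′ y))))

  ∑-*-∑ : ∀ {A B : Set} (xs : List A) (ys : List B) (f : A → Carrier) (g : B → Carrier) →
          ∑ xs f * ∑ ys g ≈ ∑ xs (λ x → ∑ ys (λ y → f x * g y))
  ∑-*-∑ xs ys f g =
    ≈-trans (*-distribʳ-∑ xs (∑ ys g) f) (∑-cong xs (λ x → *-distribˡ-∑ ys (f x) g))

  ∑-++ : ∀ {A : Set} (xs ys : List A) (f : A → Carrier) → ∑ (xs L.++ ys) f ≈ ∑ xs f + ∑ ys f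
  ∑-++ [] ys f = ≈-sym (+-identityˡ _)
  ∑-++ (x ∷ xs) ys f = ≈-trans (+-congˡ (∑-++ xs ys f)) (≈-sym (+-assoc _ _ _))

  ∑-map : ∀ {A B : Set} (g : A → B) (xs : List A) (f : B → Carrier) → ∑ (map g xs) f ≈ ∑ xs (f ∘ g)
  ∑-map g [] f = ≈-refl
  ∑-map g (x ∷ xs) f = +-congˡ (∑-map g xs f)

  ∑-concatMap : ∀ {A B : Set} (g : A → List B) (xs : List A) (f : B → Carrier) →
                ∑ (concatMap g xs) f ≈ ∑ xs (λ x → ∑ (g x) f)
  ∑-concatMap g [] f = ≈-refl
  ∑-concatMap g (x ∷ xs) f = ≈-trans (∑-++ (g x) (concatMap g xs) f) (+-congˡ (∑-concatMap g xs f))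

  ∑-const : ∀ {A : Set} (xs : List A) c → ∑ xs (λ _ → c) ≈ ι (length xs) * c
  ∑-const [] c = ≈-sym (zeroˡ c)
  ∑-const (x ∷ xs) c =
    ≈-trans (+-cong (≈-sym (*-identityˡ c)) (∑-const xs c)) (≈-sym (distribʳ c 1# (ι (length xs))))

  ∑-ind : ∀ {A : Set} (xs : List A) (p : A → Bool) → ∑ xs (ind ∘ p) ≈ ι (length (filterᵇ p xs))
  ∑-ind [] p = ≈-refl
  ∑-ind (x ∷ xs) p with p x
  ... | true = +-congˡ (∑-ind xs p)
  ... | false = ≈-trans (+-identityˡ _) (∑-ind xs p)

  ∑-allVecs-suc : ∀ {A : Set} (xs : List A) k (f : Vec A (suc k) → Carrier) →
                  ∑ (allVecs xs (suc k)) f ≈ ∑ xs (λ x → ∑ (allVecs xs k) (λ v → f (x V.∷ v)))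
  ∑-allVecs-suc xs k f =
    ≈-trans (∑-concatMap _ xs f) (∑-cong xs (λ x → ∑-map (x V.∷_) (allVecs xs k) f))

  ∑-bitLists-suc : ∀ N (f : List Bool → Carrier) →
    ∑ (bitLists (suc N)) f ≈ ∑ (bitLists N) (λ G → f (true ∷ G)) + ∑ (bitLists N) (λ G → f (false ∷ G))
  ∑-bitLists-suc N f = begin
    ∑ (bitLists (suc N)) f
      ≈⟨ ∑-map V.toList (allVecs bits (suc N)) f ⟩
    ∑ (allVecs bits (suc N)) (f ∘ V.toList)
      ≈⟨ ∑-allVecs-suc bits N (f ∘ V.toList) ⟩
    ∑ (allVecs bits N) (λ v → f (true ∷ V.toList v)) + (∑ (allVecs bits N) (λ v → f (false ∷ V.toList v)) + 0#)
      ≈⟨ +-cong (≈-sym (∑-map V.toList (allVecs bits N) (λ G → f (true ∷ G))))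
                (≈-trans (+-identityʳ _) (≈-sym (∑-map V.toList (allVecs bits N) (λ G → f (false ∷ G))))) ⟩
    ∑ (bitLists N) (λ G → f (true ∷ G)) + ∑ (bitLists N) (λ G → f (false ∷ G))
      ∎
    where
    open ≈-Reasoning setoid
    bits = true ∷ false ∷ []

  ∑-allFin-suc : ∀ m (f : Fin (suc m) → Carrier) → ∑ (allFin (suc m)) f ≈ f F.zero + ∑ (allFin m) (f ∘ F.suc)
  ∑-allFin-suc m f = +-congˡ (≈-trans (≡⇒≈ (cong (λ xs → ∑ xs f) (tabulate-suc m))) (∑-map F.suc (allFin m) f))

  ∑-allFin-const : ∀ m c → ∑ (allFin m) (λ _ → c) ≈ ι m * c
  ∑-allFin-const m c = ≈-trans (∑-const (allFin m) c) (*-congʳ (≡⇒≈ (cong ι (length-tabulate {n = m} (λ i → i)))))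

  ∑-ind-eqFin : ∀ m (y : Fin m) → ∑ (allFin m) (λ x → ind (eqFin x y)) ≈ 1#
  ∑-ind-eqFin (suc m) F.zero = ≈-trans (∑-allFin-suc m _) (≈-trans (+-congˡ (∑-0 (allFin m))) (+-identityʳ 1#))
  ∑-ind-eqFin (suc m) (F.suc y) = ≈-trans (∑-allFin-suc m _) (≈-trans (+-identityˡ _)
    (≈-trans (∑-cong (allFin m) (λ x → ≡⇒≈ (cong ind (eqFin-suc x y)))) (∑-ind-eqFin m y)))

  ∑-allVecs-const : ∀ {m} k c → ∑ (allVecs (allFin m) k) (λ _ → c) ≈ ι (m ^ k) * c
  ∑-allVecs-const {m} zero c = ≈-trans (+-identityʳ c) (≈-sym (≈-trans (*-congʳ (+-identityʳ 1#)) (*-identityˡ c)))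
  ∑-allVecs-const {m} (suc k) c = begin
    ∑ (allVecs (allFin m) (suc k)) (λ _ → c)      ≈⟨ ∑-allVecs-suc (allFin m) k _ ⟩
    ∑ (allFin m) (λ _ → ∑ (allVecs (allFin m) k) (λ _ → c)) ≈⟨ ∑-cong (allFin m) (λ _ → ∑-allVecs-const k c) ⟩
    ∑ (allFin m) (λ _ → ι (m ^ k) * c)           ≈⟨ ∑-allFin-const m _ ⟩
    ι m * (ι (m ^ k) * c)                        ≈⟨ ≈-sym (*-assoc _ _ _) ⟩
    (ι m * ι (m ^ k)) * c                        ≈⟨ *-congʳ (≈-sym (ι-* m (m ^ k))) ⟩
    ι (m ^ suc k) * c                            ∎
    where open ≈-Reasoning setoid

  ∑-allVecs-agreeing : ∀ {m} k (q : Fin k → Bool) (f : Fin k → Fin m) →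
    ∑ (allVecs (allFin m) k) (λ ψ → ind (all (λ x → q x ∨ eqFin (V.lookup ψ x) (f x)) (allFin k)))
      ≈ ι (m ^ length (filterᵇ q (allFin k)))
  ∑-allVecs-agreeing zero q f = ≈-refl
  ∑-allVecs-agreeing {m} (suc k) q f = begin
    ∑ (allVecs (allFin m) (suc k)) (λ ψ → ind (all (agree ψ) (allFin (suc k))))
      ≈⟨ ∑-allVecs-suc (allFin m) k _ ⟩
    ∑ (allFin m) (λ x → ∑ AV (λ ψ → ind (all (agree (x V.∷ ψ)) (allFin (suc k)))))
      ≈⟨ ∑-cong (allFin m) (λ x → ∑-cong AV (λ ψ →
           ≈-trans (≡⇒≈ (cong ind (all-allFin-suc (agree (x V.∷ ψ))))) (ind-∧ (first x) (all (agree′ ψ) (allFin k))))) ⟩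
    ∑ (allFin m) (λ x → ∑ AV (λ ψ → ind (first x) * ind (all (agree′ ψ) (allFin k))))
      ≈⟨ ∑-cong (allFin m) (λ x → ≈-sym (*-distribˡ-∑ AV _ _)) ⟩
    ∑ (allFin m) (λ x → ind (first x) * ∑ AV (λ ψ → ind (all (agree′ ψ) (allFin k))))
      ≈⟨ ∑-cong (allFin m) (λ x → *-congˡ (∑-allVecs-agreeing k (q ∘ F.suc) (f ∘ F.suc))) ⟩
    ∑ (allFin m) (λ x → ind (first x) * ι (m ^ c))
      ≈⟨ ≈-sym (*-distribʳ-∑ (allFin m) _ _) ⟩
    ∑ (allFin m) (λ x → ind (first x)) * ι (m ^ c)
      ≈⟨ first-coordinate (q F.zero) ⟩
    ι (m ^ (if q F.zero then suc else λ c → c) c)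
      ≈⟨ ≡⇒≈ (cong (λ l → ι (m ^ l)) (sym (length-filterᵇ-allFin-suc q))) ⟩
    ι (m ^ length (filterᵇ q (allFin (suc k))))
      ∎
    where
    open ≈-Reasoning setoid
    AV = allVecs (allFin m) k
    c = length (filterᵇ (q ∘ F.suc) (allFin k))
    agree : Vec (Fin m) (suc k) → Fin (suc k) → Bool
    agree ψ x = q x ∨ eqFin (V.lookup ψ x) (f x)
    agree′ : Vec (Fin m) k → Fin k → Bool
    agree′ ψ x = q (F.suc x) ∨ eqFin (V.lookup ψ x) (f (F.suc x))
    first : Fin m → Bool
    first x = q F.zero ∨ eqFin x (f F.zero)
    first-coordinate : ∀ b → ∑ (allFin m) (λ x → ind (b ∨ eqFin x (f F.zero))) * ι (m ^ c)
                             ≈ ι (m ^ (if b then suc else λ c → c) c)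
    first-coordinate true = ≈-trans (*-congʳ (≈-trans (∑-allFin-const m 1#) (*-identityʳ _))) (≈-sym (ι-* m (m ^ c)))
    first-coordinate false = ≈-trans (*-congʳ (∑-ind-eqFin m (f F.zero))) (*-identityˡ _)

  ∑-ind-eqSubset : ∀ m (S : Subset m) → ∑ (allSubsets m) (λ T → ind (eqSubset S T)) ≈ 1#
  ∑-ind-eqSubset zero V.[] = +-identityʳ 1#
  ∑-ind-eqSubset (suc m) (a V.∷ S) = begin
    ∑ (allSubsets (suc m)) (λ T → ind (eqSubset (a V.∷ S) T))
      ≈⟨ ∑-allVecs-suc bits m _ ⟩
    ∑ bits (λ b → ∑ (allSubsets m) (λ T → ind (eqSubset (a V.∷ S) (b V.∷ T))))
      ≈⟨ ∑-cong bits (λ b → ∑-cong (allSubsets m) (λ T →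
           ≈-trans (≡⇒≈ (cong ind (eqSubset-∷ a b S T))) (ind-∧ ⌊ a B.≟ b ⌋ (eqSubset S T)))) ⟩
    ∑ bits (λ b → ∑ (allSubsets m) (λ T → ind ⌊ a B.≟ b ⌋ * ind (eqSubset S T)))
      ≈⟨ ∑-cong bits (λ b → ≈-trans (≈-sym (*-distribˡ-∑ (allSubsets m) _ _))
                                     (≈-trans (*-congˡ (∑-ind-eqSubset m S)) (*-identityʳ (ind ⌊ a B.≟ b ⌋)))) ⟩
    ∑ bits (λ b → ind ⌊ a B.≟ b ⌋)
      ≈⟨ exactly-one a ⟩
    1# ∎
    where
    open ≈-Reasoning setoid
    bits = true ∷ false ∷ []
    exactly-one : ∀ a → ∑ bits (λ b → ind ⌊ a B.≟ b ⌋) ≈ 1#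
    exactly-one true = ≈-trans (+-congˡ (+-identityʳ 0#)) (+-identityʳ 1#)
    exactly-one false = ≈-trans (+-identityˡ _) (+-identityʳ 1#)

  ∑-ind-eqSubset² : ∀ m (S S′ : Subset m) →
    ∑ (allSubsets m) (λ T → ind (eqSubset S T) * ind (eqSubset S′ T)) ≈ ind (eqSubset S S′)
  ∑-ind-eqSubset² m S S′ = begin
    ∑ (allSubsets m) (λ T → ind (eqSubset S T) * ind (eqSubset S′ T))
      ≈⟨ ∑-cong (allSubsets m) pointwise ⟩
    ∑ (allSubsets m) (λ T → ind (eqSubset S S′) * ind (eqSubset S T))
      ≈⟨ ≈-sym (*-distribˡ-∑ (allSubsets m) _ _) ⟩
    ind (eqSubset S S′) * ∑ (allSubsets m) (λ T → ind (eqSubset S T))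
      ≈⟨ ≈-trans (*-congˡ (∑-ind-eqSubset m S)) (*-identityʳ _) ⟩
    ind (eqSubset S S′) ∎
    where
    open ≈-Reasoning setoid
    pointwise : ∀ T → ind (eqSubset S T) * ind (eqSubset S′ T) ≈ ind (eqSubset S S′) * ind (eqSubset S T)
    pointwise T with eqSubset S T in S≟T
    ... | false = ≈-trans (zeroˡ _) (≈-sym (zeroʳ _))
    ... | true rewrite sym (eqSubset⇒≡ S≟T) =
      ≈-trans (*-comm 1# (ind (eqSubset S′ S))) (*-congʳ (≡⇒≈ (cong ind (eqSubset-sym S′ S))))

  -- Orthonormality of the p-biased characters

  pow : Carrier → ℕ → Carrier
  pow x zero = 1#
  pow x (suc c) = x * pow x c

  module _ (p s t : Carrier) where

    characterProduct : ∀ {n} → List (Fin n × Fin n) → List (Fin n × Fin n) → Graph n → Carrier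
    characterProduct es L G = prodF (map (λ e → χ 𝔽 s t (edgeBit′ es G (proj₁ e) (proj₂ e))) L)

    -- E[χ_{L₁}(G) χ_{L₂}(G)] for G ∼ G(n,p), the potential edges of G being listed by es.
    crossMoment : ∀ {n} → List (Fin n × Fin n) → List (Fin n × Fin n) → List (Fin n × Fin n) → Carrier
    crossMoment es L₁ L₂ =
      ∑ (bitLists (length es)) (λ G → weight 𝔽 p G * (characterProduct es L₁ G * characterProduct es L₂ G))

    crossMoment-[] : ∀ {n} → crossMoment {n} [] [] [] ≈ 1#
    crossMoment-[] = ≈-trans (+-identityʳ _) (≈-trans (*-identityˡ _) (*-identityˡ 1#))

    bitWeight : Bool → Carrier
    bitWeight b = if b then p else (1# - p)

    bitMoment : Bool → ℕ → ℕ → Carrier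
    bitMoment b c₁ c₂ = bitWeight b * (pow (χ 𝔽 s t b) c₁ * pow (χ 𝔽 s t b) c₂)

    edgeMoment : ℕ → ℕ → Carrier
    edgeMoment c₁ c₂ = bitMoment true c₁ c₂ + bitMoment false c₁ c₂

    characterProduct-∷ : ∀ {n} (es : List (Fin n × Fin n)) e L b G →
      characterProduct (e ∷ es) L (b ∷ G) ≈ pow (χ 𝔽 s t b) (multiplicity e L) * characterProduct es (deleteEdge e L) G
    characterProduct-∷ es e [] b G = ≈-sym (*-identityʳ 1#)
    characterProduct-∷ es e ((x , y) ∷ L) b G with sameEdge e (x , y)
    ... | true = ≈-trans (*-congˡ (characterProduct-∷ es e L b G)) (≈-sym (*-assoc _ _ _))
    ... | false = ≈-trans (*-congˡ (characterProduct-∷ es e L b G)) (x∙yz≈y∙xz _ _ _)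

    crossMoment-∷ : ∀ {n} (es : List (Fin n × Fin n)) e L₁ L₂ →
      crossMoment (e ∷ es) L₁ L₂
        ≈ edgeMoment (multiplicity e L₁) (multiplicity e L₂) * crossMoment es (deleteEdge e L₁) (deleteEdge e L₂)
    crossMoment-∷ es e L₁ L₂ =
      ≈-trans (∑-bitLists-suc (length es) _) (≈-trans (+-cong (bit true) (bit false)) (≈-sym (distribʳ _ _ _)))
      where
      m₁ = multiplicity e L₁
      m₂ = multiplicity e L₂
      rest : List Bool → Carrier
      rest G = characterProduct es (deleteEdge e L₁) G * characterProduct es (deleteEdge e L₂) G
      bit : ∀ b → ∑ (bitLists (length es))
                    (λ G → weight 𝔽 p (b ∷ G) * (characterProduct (e ∷ es) L₁ (b ∷ G) * characterProduct (e ∷ es) L₂ (b ∷ G)))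
                  ≈ bitMoment b m₁ m₂ * crossMoment es (deleteEdge e L₁) (deleteEdge e L₂)
      bit b = ≈-trans (∑-cong (bitLists (length es)) factor) (≈-sym (*-distribˡ-∑ (bitLists (length es)) _ _))
        where
        open ≈-Reasoning setoid
        factor : ∀ G → weight 𝔽 p (b ∷ G) * (characterProduct (e ∷ es) L₁ (b ∷ G) * characterProduct (e ∷ es) L₂ (b ∷ G))
                       ≈ bitMoment b m₁ m₂ * (weight 𝔽 p G * rest G)
        factor G = begin
          (bitWeight b * weight 𝔽 p G) * (characterProduct (e ∷ es) L₁ (b ∷ G) * characterProduct (e ∷ es) L₂ (b ∷ G))
            ≈⟨ *-congˡ (*-cong (characterProduct-∷ es e L₁ b G) (characterProduct-∷ es e L₂ b G)) ⟩
          (bitWeight b * weight 𝔽 p G) * ((pow (χ 𝔽 s t b) m₁ * _) * (pow (χ 𝔽 s t b) m₂ * _))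
            ≈⟨ *-congˡ (interchange _ _ _ _) ⟩
          (bitWeight b * weight 𝔽 p G) * ((pow (χ 𝔽 s t b) m₁ * pow (χ 𝔽 s t b) m₂) * rest G)
            ≈⟨ interchange _ _ _ _ ⟩
          bitMoment b m₁ m₂ * (weight 𝔽 p G * rest G) ∎

    module _ (s²[1-p]≈p : ((s * s) * (1# - p)) ≈ p) (st≈1 : (s * t) ≈ 1#) where
      open ≈-Reasoning setoid

      [1-p]+p≈1 : ((1# - p) + p) ≈ 1#
      [1-p]+p≈1 = ≈-trans (+-assoc 1# (- p) p) (≈-trans (+-congˡ (-‿inverseˡ p)) (+-identityʳ 1#))

      pt≈s[1-p] : (p * t) ≈ (s * (1# - p))
      pt≈s[1-p] = begin
        p * t                      ≈⟨ *-congʳ (≈-sym s²[1-p]≈p) ⟩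
        ((s * s) * (1# - p)) * t   ≈⟨ solve 3 (λ s q t → ((s ∙ s) ∙ q) ∙ t ⊜ (s ∙ q) ∙ (s ∙ t)) ≈-refl s (1# - p) t ⟩
        (s * (1# - p)) * (s * t)   ≈⟨ ≈-trans (*-congˡ st≈1) (*-identityʳ _) ⟩
        s * (1# - p)               ∎

      pt²≈1-p : (p * (t * t)) ≈ (1# - p)
      pt²≈1-p = begin
        p * (t * t)                      ≈⟨ *-congʳ (≈-sym s²[1-p]≈p) ⟩
        ((s * s) * (1# - p)) * (t * t)   ≈⟨ solve 3 (λ s q t → ((s ∙ s) ∙ q) ∙ (t ∙ t) ⊜ q ∙ ((s ∙ t) ∙ (s ∙ t))) ≈-refl s (1# - p) t ⟩
        (1# - p) * ((s * t) * (s * t))   ≈⟨ ≈-trans (*-congˡ (≈-trans (*-cong st≈1 st≈1) (*-identityʳ 1#))) (*-identityʳ _) ⟩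
        1# - p                           ∎

      edgeMoment-0-0 : edgeMoment 0 0 ≈ 1#
      edgeMoment-0-0 = begin
        p * (1# * 1#) + (1# - p) * (1# * 1#)  ≈⟨ +-cong (≈-trans (*-congˡ (*-identityʳ 1#)) (*-identityʳ p))
                                                         (≈-trans (*-congˡ (*-identityʳ 1#)) (*-identityʳ _)) ⟩
        p + (1# - p)                          ≈⟨ ≈-trans (+-comm p (1# - p)) [1-p]+p≈1 ⟩
        1#                                    ∎

      edgeMoment-1-0 : edgeMoment 1 0 ≈ 0#
      edgeMoment-1-0 = begin
        p * ((- t) * 1# * 1#) + (1# - p) * (s * 1# * 1#)
          ≈⟨ +-cong (*-congˡ (≈-trans (*-identityʳ _) (*-identityʳ _))) (*-congˡ (≈-trans (*-identityʳ _) (*-identityʳ _))) ⟩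
        p * (- t) + (1# - p) * s
          ≈⟨ +-cong (≈-trans (≈-sym (-‿distribʳ-* p t)) (-‿cong (≈-trans pt≈s[1-p] (*-comm s (1# - p))))) ≈-refl ⟩
        - ((1# - p) * s) + (1# - p) * s
          ≈⟨ -‿inverseˡ _ ⟩
        0# ∎

      edgeMoment-0-1 : edgeMoment 0 1 ≈ 0#
      edgeMoment-0-1 = ≈-trans (+-cong (*-congˡ (*-comm 1# _)) (*-congˡ (*-comm 1# _))) edgeMoment-1-0

      edgeMoment-1-1 : edgeMoment 1 1 ≈ 1#
      edgeMoment-1-1 = begin
        p * ((- t) * 1# * ((- t) * 1#)) + (1# - p) * (s * 1# * (s * 1#))
          ≈⟨ +-cong (*-congˡ (*-cong (*-identityʳ _) (*-identityʳ _))) (*-congˡ (*-cong (*-identityʳ _) (*-identityʳ _))) ⟩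
        p * ((- t) * (- t)) + (1# - p) * (s * s)
          ≈⟨ +-cong (*-congˡ (≈-trans (≈-sym (-‿distribˡ-* t (- t))) (≈-trans (-‿cong (≈-sym (-‿distribʳ-* t t))) (-‿involutive (t * t)))))
                    (*-comm (1# - p) (s * s)) ⟩
        p * (t * t) + (s * s) * (1# - p)
          ≈⟨ +-cong pt²≈1-p s²[1-p]≈p ⟩
        (1# - p) + p
          ≈⟨ [1-p]+p≈1 ⟩
        1# ∎

      crossMoment-∷-value : ∀ {n} (es : List (Fin n × Fin n)) e L₁ L₂ {c₁ c₂ v} →
        multiplicity e L₁ ≡ c₁ → multiplicity e L₂ ≡ c₂ → edgeMoment c₁ c₂ ≈ v →
        crossMoment es (deleteEdge e L₁) (deleteEdge e L₂) ≈ 1# → crossMoment (e ∷ es) L₁ L₂ ≈ v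
      crossMoment-∷-value es e L₁ L₂ refl refl edge≈v rest≈1 =
        ≈-trans (crossMoment-∷ es e L₁ L₂) (≈-trans (*-cong edge≈v rest≈1) (*-identityʳ _))

      crossMoment-0-or-1 : ∀ {n} (es L₁ L₂ : List (Fin n × Fin n)) → L₁ ⊆ₑ es → L₂ ⊆ₑ es →
        Distinct L₁ → Distinct L₂ → crossMoment es L₁ L₂ ≈ 0# ⊎ (crossMoment es L₁ L₂ ≈ 1# × L₁ ⊆ₑ L₂ × L₂ ⊆ₑ L₁)
      crossMoment-0-or-1 {n} [] L₁ L₂ L₁⊆[] L₂⊆[] _ _ rewrite ⊆ₑ-[] L₁⊆[] | ⊆ₑ-[] L₂⊆[] =
        inj₂ (crossMoment-[] {n} , All.[] , All.[])
      crossMoment-0-or-1 (e ∷ es) L₁ L₂ L₁⊆ L₂⊆ d₁ d₂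
        with crossMoment-0-or-1 es (deleteEdge e L₁) (deleteEdge e L₂) (deleteEdge-⊆ₑ e L₁ L₁⊆) (deleteEdge-⊆ₑ e L₂ L₂⊆)
               (Distinct-deleteEdge e d₁) (Distinct-deleteEdge e d₂)
           | multiplicity-distinct e L₁ d₁ | multiplicity-distinct e L₂ d₂
      ... | inj₁ rest≈0 | _ | _ =
        inj₁ (≈-trans (crossMoment-∷ es e L₁ L₂) (≈-trans (*-congˡ rest≈0) (zeroʳ _)))
      ... | inj₂ (rest≈1 , _) | inj₁ (m₁≡0 , _) | inj₂ (m₂≡1 , _) =
        inj₁ (crossMoment-∷-value es e L₁ L₂ m₁≡0 m₂≡1 edgeMoment-0-1 rest≈1)
      ... | inj₂ (rest≈1 , _) | inj₂ (m₁≡1 , _) | inj₁ (m₂≡0 , _) =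
        inj₁ (crossMoment-∷-value es e L₁ L₂ m₁≡1 m₂≡0 edgeMoment-1-0 rest≈1)
      ... | inj₂ (rest≈1 , ⊆₁₂ , ⊆₂₁) | inj₁ (m₁≡0 , absent₁) | inj₁ (m₂≡0 , absent₂) =
        inj₂ (crossMoment-∷-value es e L₁ L₂ m₁≡0 m₂≡0 edgeMoment-0-0 rest≈1 ,
              ⊆ₑ-deleteEdge⁻ e (All.map never absent₁) ⊆₁₂ , ⊆ₑ-deleteEdge⁻ e (All.map never absent₂) ⊆₂₁)
        where
        never : ∀ {q B} → sameEdge e q ≡ false → SameEdge e q → Any (SameEdge q) B
        never {q} e≁q e~q = ⊥-elim (sameEdge≡false⇒¬SameEdge e q e≁q e~q)
      ... | inj₂ (rest≈1 , ⊆₁₂ , ⊆₂₁) | inj₂ (m₁≡1 , e∈L₁) | inj₂ (m₂≡1 , e∈L₂) =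
        inj₂ (crossMoment-∷-value es e L₁ L₂ m₁≡1 m₂≡1 edgeMoment-1-1 rest≈1 ,
              ⊆ₑ-deleteEdge⁻ e (via e∈L₂) ⊆₁₂ , ⊆ₑ-deleteEdge⁻ e (via e∈L₁) ⊆₂₁)
        where
        via : ∀ {A B} → Any (SameEdge e) B → All (λ q → SameEdge e q → Any (SameEdge q) B) A
        via e∈B = All.tabulate (λ _ e~q → Any.map (SameEdge-trans (SameEdge-sym e~q)) e∈B)

  -- Expanding E tr(M_α M_αᵀ)

  ∑∑-comm-∑∑ : ∀ {A B C D : Set} (as : List A) (bs : List B) (cs : List C) (ds : List D) (f : A → B → C → D → Carrier) →
    ∑ as (λ a → ∑ bs (λ b → ∑ cs (λ c → ∑ ds (f a b c)))) ≈ ∑ cs (λ c → ∑ ds (λ d → ∑ as (λ a → ∑ bs (λ b → f a b c d))))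
  ∑∑-comm-∑∑ as bs cs ds f = begin
    ∑ as (λ a → ∑ bs (λ b → ∑ cs (λ c → ∑ ds (f a b c))))
      ≈⟨ ∑-cong as (λ a → ∑-comm bs cs _) ⟩
    ∑ as (λ a → ∑ cs (λ c → ∑ bs (λ b → ∑ ds (f a b c))))
      ≈⟨ ∑-comm as cs _ ⟩
    ∑ cs (λ c → ∑ as (λ a → ∑ bs (λ b → ∑ ds (f a b c))))
      ≈⟨ ∑-cong cs (λ c → ∑-cong as (λ a → ∑-comm bs ds _)) ⟩
    ∑ cs (λ c → ∑ as (λ a → ∑ ds (λ d → ∑ bs (λ b → f a b c d))))
      ≈⟨ ∑-cong cs (λ c → ∑-comm as ds _) ⟩
    ∑ cs (λ c → ∑ ds (λ d → ∑ as (λ a → ∑ bs (λ b → f a b c d)))) ∎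
    where open ≈-Reasoning setoid

  ind-*-≤ : ∀ b {y} → 0# ≤ y → (ind b * y) ≤ y
  ind-*-≤ true 0≤y = ≈⇒≤ (*-identityˡ _)
  ind-*-≤ false 0≤y = ≤-respˡ-≈ (≈-sym (zeroˡ _)) 0≤y

  module _ (p s t : Carrier) (n : ℕ) (α : Shape) where
    private
      Maps = allVecs (allFin n) (k α)
      χα : Vec (Fin n) (k α) → Graph n → Carrier
      χα = χImage 𝔽 s t α

    Mentry² : ∀ G S T → (Mentry 𝔽 s t n α G S T * Mentry 𝔽 s t n α G S T)
      ≈ ∑ Maps (λ φ → ∑ Maps (λ ψ → (ind (selectsᵇ α φ S T) * ind (selectsᵇ α ψ S T)) * (χα φ G * χα ψ G)))
    Mentry² G S T = ≈-trans (∑-*-∑ Maps Maps _ _) (∑-cong Maps (λ φ → ∑-cong Maps (λ ψ →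
      ≈-trans (*-cong (if-then-0≈ind-* (selectsᵇ α φ S T) (χα φ G)) (if-then-0≈ind-* (selectsᵇ α ψ S T) (χα ψ G)))
              (interchange _ _ _ _))))

    ∑∑-ind-selects² : ∀ φ ψ →
      ∑ (allSubsets n) (λ S → ∑ (allSubsets n) (λ T → ind (selectsᵇ α φ S T) * ind (selectsᵇ α ψ S T)))
        ≈ ind (compatibleᵇ α φ ψ)
    ∑∑-ind-selects² φ ψ = begin
      ∑ SS (λ S → ∑ SS (λ T → ind (selectsᵇ α φ S T) * ind (selectsᵇ α ψ S T)))
        ≈⟨ ∑-cong SS (λ S → ∑-cong SS (λ T → split S T)) ⟩
      ∑ SS (λ S → ∑ SS (λ T → (ind iφ * ind iψ) * ((ind (eqSubset Uφ S) * ind (eqSubset Uψ S)) * (ind (eqSubset Vφ T) * ind (eqSubset Vψ T)))))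
        ≈⟨ ∑-cong SS (λ S → ≈-trans (≈-sym (*-distribˡ-∑ SS _ _)) (*-congˡ (≈-sym (*-distribˡ-∑ SS _ _)))) ⟩
      ∑ SS (λ S → (ind iφ * ind iψ) * ((ind (eqSubset Uφ S) * ind (eqSubset Uψ S)) * ∑ SS (λ T → ind (eqSubset Vφ T) * ind (eqSubset Vψ T))))
        ≈⟨ ∑-cong SS (λ S → *-congˡ (*-congˡ (∑-ind-eqSubset² n Vφ Vψ))) ⟩
      ∑ SS (λ S → (ind iφ * ind iψ) * ((ind (eqSubset Uφ S) * ind (eqSubset Uψ S)) * ind (eqSubset Vφ Vψ)))
        ≈⟨ ≈-trans (≈-sym (*-distribˡ-∑ SS _ _)) (*-congˡ (≈-sym (*-distribʳ-∑ SS _ _))) ⟩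
      (ind iφ * ind iψ) * (∑ SS (λ S → ind (eqSubset Uφ S) * ind (eqSubset Uψ S)) * ind (eqSubset Vφ Vψ))
        ≈⟨ *-congˡ (*-congʳ (∑-ind-eqSubset² n Uφ Uψ)) ⟩
      (ind iφ * ind iψ) * (ind (eqSubset Uφ Uψ) * ind (eqSubset Vφ Vψ))
        ≈⟨ ≈-sym (≈-trans (ind-∧ (iφ ∧ iψ) _) (*-cong (ind-∧ iφ iψ) (ind-∧ (eqSubset Uφ Uψ) _))) ⟩
      ind (compatibleᵇ α φ ψ) ∎
      where
      open ≈-Reasoning setoid
      SS = allSubsets n
      iφ = injectiveᵇ φ
      iψ = injectiveᵇ ψ
      Uφ = image φ (U α)
      Uψ = image ψ (U α)
      Vφ = image φ (V α)
      Vψ = image ψ (V α)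
      split : ∀ S T → ind (selectsᵇ α φ S T) * ind (selectsᵇ α ψ S T)
        ≈ (ind iφ * ind iψ) * ((ind (eqSubset Uφ S) * ind (eqSubset Uψ S)) * (ind (eqSubset Vφ T) * ind (eqSubset Vψ T)))
      split S T =
        ≈-trans (*-cong (≈-trans (ind-∧ iφ _) (*-congˡ (ind-∧ (eqSubset Uφ S) _)))
                        (≈-trans (ind-∧ iψ _) (*-congˡ (ind-∧ (eqSubset Uψ S) _))))
                (≈-trans (interchange _ _ _ _) (*-congˡ (interchange _ _ _ _)))

    trMMt-expand : ∀ G → trMMt 𝔽 s t n α G ≈ ∑ Maps (λ φ → ∑ Maps (λ ψ → ind (compatibleᵇ α φ ψ) * (χα φ G * χα ψ G)))
    trMMt-expand G = begin
      trMMt 𝔽 s t n α G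
        ≈⟨ ∑-cong SS (λ S → ∑-cong SS (Mentry² G S)) ⟩
      ∑ SS (λ S → ∑ SS (λ T → ∑ Maps (λ φ → ∑ Maps (λ ψ → sel² φ ψ S T * (χα φ G * χα ψ G)))))
        ≈⟨ ∑∑-comm-∑∑ SS SS Maps Maps _ ⟩
      ∑ Maps (λ φ → ∑ Maps (λ ψ → ∑ SS (λ S → ∑ SS (λ T → sel² φ ψ S T * (χα φ G * χα ψ G)))))
        ≈⟨ ∑-cong Maps (λ φ → ∑-cong Maps (λ ψ →
             ≈-trans (∑-cong SS (λ S → ≈-sym (*-distribʳ-∑ SS _ _))) (≈-sym (*-distribʳ-∑ SS _ _)))) ⟩
      ∑ Maps (λ φ → ∑ Maps (λ ψ → ∑ SS (λ S → ∑ SS (sel² φ ψ S)) * (χα φ G * χα ψ G)))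
        ≈⟨ ∑-cong Maps (λ φ → ∑-cong Maps (λ ψ → *-congʳ (∑∑-ind-selects² φ ψ))) ⟩
      ∑ Maps (λ φ → ∑ Maps (λ ψ → ind (compatibleᵇ α φ ψ) * (χα φ G * χα ψ G))) ∎
      where
      open ≈-Reasoning setoid
      SS = allSubsets n
      sel² : _ → _ → Subset n → Subset n → Carrier
      sel² φ ψ S T = ind (selectsᵇ α φ S T) * ind (selectsᵇ α ψ S T)

    χImage≡characterProduct : ∀ φ G → χα φ G ≡ characterProduct p s t (pairs n) (edgeImage α φ) G
    χImage≡characterProduct φ G = cong prodF (map-∘ (E α))

    expectedTr-expand : expectedTr 𝔽 p s t n α
      ≈ ∑ Maps (λ φ → ∑ Maps (λ ψ → ind (compatibleᵇ α φ ψ) * crossMoment p s t (pairs n) (edgeImage α φ) (edgeImage α ψ)))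
    expectedTr-expand = begin
      ∑ GG (λ G → weight 𝔽 p G * trMMt 𝔽 s t n α G)
        ≈⟨ ∑-cong GG (λ G → ≈-trans (*-congˡ (trMMt-expand G))
             (≈-trans (*-distribˡ-∑ Maps _ _) (∑-cong Maps (λ φ → *-distribˡ-∑ Maps _ _)))) ⟩
      ∑ GG (λ G → ∑ Maps (λ φ → ∑ Maps (λ ψ → weight 𝔽 p G * (ind (compatibleᵇ α φ ψ) * (χα φ G * χα ψ G)))))
        ≈⟨ ≈-trans (∑-comm GG Maps _) (∑-cong Maps (λ φ → ∑-comm GG Maps _)) ⟩
      ∑ Maps (λ φ → ∑ Maps (λ ψ → ∑ GG (λ G → weight 𝔽 p G * (ind (compatibleᵇ α φ ψ) * (χα φ G * χα ψ G)))))
        ≈⟨ ∑-cong Maps (λ φ → ∑-cong Maps (λ ψ → ≈-trans (∑-cong GG (λ G → x∙yz≈y∙xz _ _ _)) (≈-sym (*-distribˡ-∑ GG _ _)))) ⟩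
      ∑ Maps (λ φ → ∑ Maps (λ ψ → ind (compatibleᵇ α φ ψ) * ∑ GG (λ G → weight 𝔽 p G * (χα φ G * χα ψ G))))
        ≈⟨ ∑-cong Maps (λ φ → ∑-cong Maps (λ ψ → *-congˡ (∑-cong GG (λ G → *-congˡ
             (≡⇒≈ (≡.cong₂ _*_ (χImage≡characterProduct φ G) (χImage≡characterProduct ψ G))))))) ⟩
      ∑ Maps (λ φ → ∑ Maps (λ ψ → ind (compatibleᵇ α φ ψ) * crossMoment p s t (pairs n) (edgeImage α φ) (edgeImage α ψ))) ∎
      where
      open ≈-Reasoning setoid
      GG = allGraphs n

  module _ (p s t : Carrier) (s²[1-p]≈p : ((s * s) * (1# - p)) ≈ p) (st≈1 : (s * t) ≈ 1#)
           (n : ℕ) (α : Shape) (proper : Proper α) where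
    private
      Maps = allVecs (allFin n) (k α)
      Auts = allVecs (allFin (k α)) (k α)

    agreeingAutomorphisms : Vec (Fin n) (k α) → Vec (Fin n) (k α) → Carrier
    agreeingAutomorphisms φ ψ = ∑ Auts (λ σ → ind (isAutᵇ α σ) * ind (agreesOffIsolatedᵇ α ψ φ σ))

    agreeingAutomorphisms-nonneg : ∀ φ ψ → 0# ≤ agreeingAutomorphisms φ ψ
    agreeingAutomorphisms-nonneg φ ψ =
      ∑-nonneg Auts (λ σ → *-nonneg (ind-nonneg (isAutᵇ α σ)) (ind-nonneg (agreesOffIsolatedᵇ α ψ φ σ)))

    pairTerm-≤ : ∀ φ ψ → (ind (compatibleᵇ α φ ψ) * crossMoment p s t (pairs n) (edgeImage α φ) (edgeImage α ψ))
                          ≤ (ind (injectiveᵇ φ) * agreeingAutomorphisms φ ψ)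
    pairTerm-≤ φ ψ with compatibleᵇ α φ ψ in compatible
    ... | false = ≤-respˡ-≈ (≈-sym (zeroˡ _)) (*-nonneg (ind-nonneg (injectiveᵇ φ)) (agreeingAutomorphisms-nonneg φ ψ))
    ... | true with compatibleᵇ⇒ α φ ψ compatible
    ... | φ-inj , ψ-inj , φU≡ψU , φV≡ψV
        with crossMoment-0-or-1 p s t s²[1-p]≈p st≈1 (pairs n) (edgeImage α φ) (edgeImage α ψ)
               (edgeImage-⊆ₑ-pairs α φ φ-inj) (edgeImage-⊆ₑ-pairs α ψ ψ-inj)
               (edgeImage-distinct α φ φ-inj proper) (edgeImage-distinct α ψ ψ-inj proper)
    ... | inj₁ moment≈0 =
      ≤-respˡ-≈ (≈-sym (≈-trans (*-congˡ moment≈0) (zeroʳ _))) (*-nonneg (ind-nonneg (injectiveᵇ φ)) (agreeingAutomorphisms-nonneg φ ψ))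
    ... | inj₂ (moment≈1 , φ⊆ψ , ψ⊆φ) = begin
      1# * crossMoment p s t (pairs n) (edgeImage α φ) (edgeImage α ψ)
        ≈⟨ ≈-trans (*-identityˡ _) moment≈1 ⟩
      1#
        ≈⟨ ≈-sym (≈-trans (*-cong (≡⇒≈ (cong ind σ-aut)) (≡⇒≈ (cong ind σ-agrees))) (*-identityˡ 1#)) ⟩
      ind (isAutᵇ α σ) * ind (agreesOffIsolatedᵇ α ψ φ σ)
        ≤⟨ term≤∑ Auts (λ σ → *-nonneg (ind-nonneg (isAutᵇ α σ)) (ind-nonneg (agreesOffIsolatedᵇ α ψ φ σ)))
                   (∈-allVecs (allFin (k α)) σ (λ _ → ∈-allFin _)) ⟩
      agreeingAutomorphisms φ ψ
        ≈⟨ ≈-sym (≈-trans (*-congʳ (≡⇒≈ (cong ind φ-inj))) (*-identityˡ _)) ⟩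
      ind (injectiveᵇ φ) * agreeingAutomorphisms φ ψ ∎
      where
      open ≤-Reasoning poset
      automorphism = equalEdgeImages⇒automorphism α proper φ ψ φ-inj ψ-inj φU≡ψU φV≡ψV φ⊆ψ ψ⊆φ
      σ = proj₁ automorphism
      σ-aut = proj₁ (proj₂ automorphism)
      σ-agrees = proj₂ (proj₂ automorphism)

    ∑-agreeingAutomorphisms : ∀ φ → ∑ Maps (agreeingAutomorphisms φ) ≈ ι (autCount α) * ι (n ^ isolatedCount α)
    ∑-agreeingAutomorphisms φ = begin
      ∑ Maps (λ ψ → ∑ Auts (λ σ → ind (isAutᵇ α σ) * ind (agreesOffIsolatedᵇ α ψ φ σ)))
        ≈⟨ ∑-comm Maps Auts _ ⟩
      ∑ Auts (λ σ → ∑ Maps (λ ψ → ind (isAutᵇ α σ) * ind (agreesOffIsolatedᵇ α ψ φ σ)))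
        ≈⟨ ∑-cong Auts (λ σ → ≈-trans (≈-sym (*-distribˡ-∑ Maps _ _))
             (*-congˡ (∑-allVecs-agreeing (k α) (isolatedᵇ α) (λ x → V.lookup φ (V.lookup σ x))))) ⟩
      ∑ Auts (λ σ → ind (isAutᵇ α σ) * ι (n ^ isolatedCount α))
        ≈⟨ ≈-trans (≈-sym (*-distribʳ-∑ Auts _ _)) (*-congʳ (∑-ind Auts (isAutᵇ α))) ⟩
      ι (autCount α) * ι (n ^ isolatedCount α) ∎
      where open ≈-Reasoning setoid

    expectedTr-≤ : expectedTr 𝔽 p s t n α ≤ ι (autCount α *ℕ (n ^ (k α +ℕ isolatedCount α)))
    expectedTr-≤ = begin
      expectedTr 𝔽 p s t n α
        ≈⟨ expectedTr-expand p s t n α ⟩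
      ∑ Maps (λ φ → ∑ Maps (λ ψ → ind (compatibleᵇ α φ ψ) * crossMoment p s t (pairs n) (edgeImage α φ) (edgeImage α ψ)))
        ≤⟨ ∑-mono Maps (λ φ → ∑-mono Maps (pairTerm-≤ φ)) ⟩
      ∑ Maps (λ φ → ∑ Maps (λ ψ → ind (injectiveᵇ φ) * agreeingAutomorphisms φ ψ))
        ≈⟨ ∑-cong Maps (λ φ → ≈-trans (≈-sym (*-distribˡ-∑ Maps _ _)) (*-congˡ (∑-agreeingAutomorphisms φ))) ⟩
      ∑ Maps (λ φ → ind (injectiveᵇ φ) * bound)
        ≤⟨ ∑-mono Maps (λ φ → ind-*-≤ (injectiveᵇ φ) (*-nonneg (ι-nonneg (autCount α)) (ι-nonneg (n ^ isolatedCount α)))) ⟩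
      ∑ Maps (λ _ → bound)
        ≈⟨ ∑-allVecs-const (k α) bound ⟩
      ι (n ^ k α) * (ι (autCount α) * ι (n ^ isolatedCount α))
        ≈⟨ x∙yz≈y∙xz _ _ _ ⟩
      ι (autCount α) * (ι (n ^ k α) * ι (n ^ isolatedCount α))
        ≈⟨ *-congˡ (≈-trans (≈-sym (ι-* (n ^ k α) _)) (≡⇒≈ (cong ι (sym (^-distribˡ-+-* n (k α) (isolatedCount α)))))) ⟩
      ι (autCount α) * ι (n ^ (k α +ℕ isolatedCount α))
        ≈⟨ ≈-sym (ι-* (autCount α) _) ⟩
      ι (autCount α *ℕ (n ^ (k α +ℕ isolatedCount α))) ∎
      where
      open ≤-Reasoning poset
      bound = ι (autCount α) * ι (n ^ isolatedCount α)

mainTheorem11 : (𝔽 : OrderedField) → let open OrderedField 𝔽 in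
    (p s t : Carrier) → 0# < p → p < 1# → 0# < s → ((s * s) * (1# - p)) ≈ p → (s * t) ≈ 1# →
    (n : ℕ) (α : Shape) → Proper α →
    expectedTr 𝔽 p s t n α ≤ ι (autCount α *ℕ (n ^ (k α +ℕ isolatedCount α)))
mainTheorem11 𝔽 p s t _ _ _ s²[1-p]≈p st≈1 n α proper = expectedTr-≤ 𝔽 p s t s²[1-p]≈p st≈1 n α proper
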